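{- We have the double coset decomposition $$ \Gamma_g = \Gamma_g(1,2)\,\Delta_g(\mathbb{Z}) \;\cup\; \Gamma_g(1,2)\begin{pmatrix} I_g & 0 \\ I_g & I_g \end{pmatrix}\Delta_g(\mathbb{Z}), $$ where $I_g$ denotes the $g\times g$ identity matrix. The first double coset contains $2^g$ single (right) cosets of $\Gamma_g(1,2)$, the second contains $2^{g-1}(2^g-1)$.
   Context: Let $\Gamma_g=\mathrm{Sp}(g,\mathbb{Z})$, with elements written as $\begin{pmatrix}A&B\\C&D\end{pmatrix}$ in $g\times g$ blocks. For a $g\times g$ matrix $X$ let $X_0$ denote its diagonal. The theta group $\Gamma_g(1,2)$ is the subgroup of $\Gamma_g$ with $(AB')_0\equiv (CD')_0\equiv 0 \bmod 2$; equivalently it is the stabilizer of the zero characteristic under the action of $\Gamma_g$ on $\mathbb{F}_2^{2g}$ given by $\zeta\cdot\gamma=\gamma'\zeta+\begin{bmatrix}(A'C)_0\\(B'D)_0\end{bmatrix}$. $\Delta_g(\mathbb{Z})$ is the subgroup of $\Gamma_g$ consisting of elements with $C=0$. -}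

module Defs where

open import Data.Nat as ℕ using (ℕ; zero; suc)
open import Data.Fin using (Fin; zero; suc; _≟_)
open import Data.Integer using (ℤ; +_; _+_; _*_; -_; _-_)
open import Data.Integer.Divisibility using (_∣_)
open import Data.Product using (Σ; ∃; ∃-syntax; _×_; _,_; proj₁)
open import Data.Sum using (_⊎_)
open import Relation.Binary.PropositionalEquality using (_≡_)
open import Relation.Nullary using (¬_; yes; no)

Mat : ℕ → Set
Mat g = Fin g → Fin g → ℤ

sumℤ : ∀ {n} → (Fin n → ℤ) → ℤ
sumℤ {zero}  f = + 0
sumℤ {suc n} f = f zero + sumℤ (λ i → f (suc i))

infixl 7 _⊗_
_⊗_ : ∀ {g} → Mat g → Mat g → Mat g
(X ⊗ Y) i j = sumℤ (λ k → X i k * Y k j)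

infixl 6 _⊕_ _⊖_
_⊕_ : ∀ {g} → Mat g → Mat g → Mat g
(X ⊕ Y) i j = X i j + Y i j

_⊖_ : ∀ {g} → Mat g → Mat g → Mat g
(X ⊖ Y) i j = X i j - Y i j

neg : ∀ {g} → Mat g → Mat g
neg X i j = - X i j

tr : ∀ {g} → Mat g → Mat g
tr X i j = X j i

𝟎 : ∀ {g} → Mat g
𝟎 i j = + 0

𝐈 : ∀ {g} → Mat g
𝐈 i j with i ≟ j
... | yes _ = + 1
... | no  _ = + 0

_≈_ : ∀ {g} → Mat g → Mat g → Set
X ≈ Y = ∀ i j → X i j ≡ Y i j

-- 2g × 2g integer matrices, written in g × g blocks (A B / C D)
record Block (g : ℕ) : Set where
  constructor ⟦_,_,_,_⟧
  field
    A B C D : Mat g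
open Block public

infixl 7 _·_
_·_ : ∀ {g} → Block g → Block g → Block g
M · N = ⟦ A M ⊗ A N ⊕ B M ⊗ C N , A M ⊗ B N ⊕ B M ⊗ D N
        , C M ⊗ A N ⊕ D M ⊗ C N , C M ⊗ B N ⊕ D M ⊗ D N ⟧

trB : ∀ {g} → Block g → Block g
trB M = ⟦ tr (A M) , tr (C M) , tr (B M) , tr (D M) ⟧

infix 4 _≈B_ _≈_
_≈B_ : ∀ {g} → Block g → Block g → Set
M ≈B N = (A M ≈ A N) × (B M ≈ B N) × (C M ≈ C N) × (D M ≈ D N)

J : ∀ {g} → Block g
J = ⟦ 𝟎 , 𝐈 , neg 𝐈 , 𝟎 ⟧

IsSp : ∀ {g} → Block g → Set
IsSp γ = trB γ · J · γ ≈B J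

DiagEven : ∀ {g} → Mat g → Set
DiagEven X = ∀ i → + 2 ∣ X i i

InTheta : ∀ {g} → Block g → Set
InTheta γ = IsSp γ × DiagEven (A γ ⊗ tr (B γ)) × DiagEven (C γ ⊗ tr (D γ))

InDelta : ∀ {g} → Block g → Set
InDelta γ = IsSp γ × (C γ ≈ 𝟎)

M₁ : ∀ {g} → Block g
M₁ = ⟦ 𝐈 , 𝟎 , 𝐈 , 𝐈 ⟧

InDoubleCoset : ∀ {g} → Block g → Block g → Set
InDoubleCoset m γ = ∃[ h ] ∃[ d ] InTheta h × InDelta d × (γ ≈B h · m · d)

SameRightCoset : ∀ {g} → Block g → Block g → Set
SameRightCoset γ₁ γ₂ = ∃[ h ] InTheta h × (γ₁ ≈B h · γ₂)

HasNRightCosets : ∀ {g} → Block g → ℕ → Set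
HasNRightCosets {g} m N =
  Σ (Fin N → Block g) λ r →
    (∀ i → IsSp (r i) × InDoubleCoset m (r i))
    × (∀ i j → SameRightCoset (r i) (r j) → i ≡ j)
    × (∀ γ → IsSp γ → InDoubleCoset m γ → ∃[ i ] SameRightCoset γ (r i))

𝐈B : ∀ {g} → Block g
𝐈B = ⟦ 𝐈 , 𝟎 , 𝟎 , 𝐈 ⟧

-- Reducing modulo 2, every γ ∈ Γ_g has a characteristic χ γ = ((AᵀC)₀, (BᵀD)₀) ∈ 𝔽₂²ᵍ, the image of
-- the zero characteristic under γ.  It obeys the cocycle rule χ (X · Y) = Yᵀ (χ X) + χ Y, and Γ_g(1,2)
-- consists of the h with χ hᵀ = 0, equivalently χ h = 0.  Hence χ is constant on right cosets of
-- Γ_g(1,2), and conversely χ γ = χ N forces γ N⁻¹ ∈ Γ_g(1,2).  A Gauss sum over 𝔽₂²ᵍ shows that every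
-- characteristic (α, β) is even, α · β = 0.  On Γ_g(1,2) Δ_g the first half α vanishes, on
-- Γ_g(1,2) M₁ Δ_g it does not; explicit elements of Δ_g realise every even characteristic of the right
-- kind, so the right cosets of the two double cosets are in bijection with the 2ᵍ characteristics (0, β)
-- and with the 2ᵍ⁻¹ (2ᵍ − 1) even characteristics with α ≠ 0 respectively.

module Submission where

open import Level using (Level; 0ℓ)
open import Algebra.Bundles using (CommutativeRing)
open import Algebra.Core using (Op₁; Op₂)
open import Algebra.Structures using (IsCommutativeRing)
import Algebra.Properties.Semiring.Sum as SemiringSum
open import Data.Empty using (⊥; ⊥-elim)
open import Data.Fin using (Fin; zero; suc; _≟_; combine; _↑ˡ_; _↑ʳ_; punchOut)
import Data.Fin.Properties as Finₚ
open import Data.Fin.Permutation using (Permutation; permutation)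
open import Data.Integer as ℤ using (ℤ; -[1+_]; 1ℤ; ∣_∣)
import Data.Integer.Properties as ℤₚ
open import Data.Nat as ℕ using (ℕ; zero; suc; _^_; _∸_)
open import Data.Nat.Divisibility as ℕ∣ using (divides)
import Data.Nat.Properties as ℕₚ
open import Data.Nat.Solver using (module +-*-Solver)
open import Data.Parity.Base as ℙ using (Parity; 0ℙ; 1ℙ)
import Data.Parity.Properties as ℙₚ
open import Data.Product using (Σ; ∃; ∃-syntax; _×_; _,_; proj₁; proj₂)
open import Data.Product.Function.NonDependent.Setoid using (_×-inverse_)
open import Data.Product.Relation.Binary.Pointwise.NonDependent as Pointwise× using (_×ₛ_)
open import Data.Sum using (_⊎_; inj₁; inj₂)
open import Data.Sum.Function.Setoid using (_⊎-inverse_)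
open import Data.Sum.Relation.Binary.Pointwise as Pointwise⊎ using (_⊎ₛ_; inj₁; inj₂)
open import Data.Vec.Functional using (Vector; _∷_; head; tail)
open import Function using (_∘_)
open import Function.Bundles using (Inverse)
import Function.Construct.Composition as Compose
import Function.Construct.Symmetry as Symmetry
open import Relation.Binary.Bundles using (Setoid)
import Relation.Binary.Construct.On as On
open import Relation.Binary.PropositionalEquality hiding (J)
import Relation.Binary.Reasoning.Setoid as SetoidReasoning
open import Relation.Nullary using (¬_; yes; no)

open import Algebra.Properties.CommutativeSemigroup ℤₚ.*-commutativeSemigroup using () renaming (interchange to ℤ*-interchange)

-- Block matrices over a commutative ring

-- The notions of Defs for any ring whose equality is _≡_; instantiated at ℤ and at Parity = 𝔽₂.
module Matrices {R : Set} {add mul : Op₂ R} {negate : Op₁ R} {zero# one# : R}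
                (isCommutativeRing : IsCommutativeRing _≡_ add mul negate zero# one#) where

  commutativeRing : CommutativeRing 0ℓ 0ℓ
  commutativeRing = record { isCommutativeRing = isCommutativeRing }

  open CommutativeRing commutativeRing public
    using (_+_; _*_; -_; 0#; 1#; +-assoc; +-comm; +-identityˡ; +-identityʳ; -‿inverseˡ; -‿inverseʳ;
           *-assoc; *-comm; *-identityˡ; *-identityʳ; distribˡ; distribʳ; zeroˡ; zeroʳ)
  open CommutativeRing commutativeRing using (ring; semiring; +-commutativeSemigroup)
  open import Algebra.Properties.CommutativeSemigroup +-commutativeSemigroup public
    using () renaming (interchange to +-interchange)
  open import Algebra.Properties.Ring ring public
    using (-‿distribˡ-*; -‿distribʳ-*; -‿involutive; -0#≈0#; -‿+-comm)
  open import Algebra.Properties.Semiring.Sum semiring public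
    using (sum; sum-cong-≗; ∑-distrib-+; ∑-comm; *-distribˡ-sum; *-distribʳ-sum; sum-replicate-zero)

  sum-zero : ∀ {n} → sum {n} (λ _ → 0#) ≡ 0#
  sum-zero {n} = sum-replicate-zero n

  sum-neg : ∀ {n} (f : Vector R n) → sum (λ i → - f i) ≡ - sum f
  sum-neg {zero}  f = sym -0#≈0#
  sum-neg {suc n} f = trans (cong (- f zero +_) (sum-neg (f ∘ suc))) (-‿+-comm _ _)

  δ : ∀ {n} → Fin n → Fin n → R
  δ zero    zero    = 1#
  δ zero    (suc j) = 0#
  δ (suc i) zero    = 0#
  δ (suc i) (suc j) = δ i j

  δ-sym : ∀ {n} (i j : Fin n) → δ i j ≡ δ j i
  δ-sym zero    zero    = refl
  δ-sym zero    (suc j) = refl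
  δ-sym (suc i) zero    = refl
  δ-sym (suc i) (suc j) = δ-sym i j

  δ-diag : ∀ {n} (i : Fin n) → δ i i ≡ 1#
  δ-diag zero    = refl
  δ-diag (suc i) = δ-diag i

  sum-δˡ : ∀ {n} (i : Fin n) (f : Vector R n) → sum (λ k → δ i k * f k) ≡ f i
  sum-δˡ {suc n} zero    f = trans (cong₂ _+_ (*-identityˡ (f zero))
                                      (trans (sum-cong-≗ (λ k → zeroˡ (f (suc k)))) (sum-zero {n})))
                           (+-identityʳ _)
  sum-δˡ (suc i) f = trans (cong₂ _+_ (zeroˡ (f zero)) (sum-δˡ i (f ∘ suc))) (+-identityˡ _)

  sum-δʳ : ∀ {n} (j : Fin n) (f : Vector R n) → sum (λ k → f k * δ k j) ≡ f j
  sum-δʳ j f = trans (sum-cong-≗ (λ k → trans (*-comm (f k) (δ k j)) (cong (_* f k) (δ-sym k j))))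
                     (sum-δˡ j f)

  Matrix : ℕ → Set
  Matrix n = Fin n → Fin n → R

  infixl 7 _⊗_
  infixl 6 _⊕_
  infix  4 _≈_

  _⊗_ : ∀ {n} → Matrix n → Matrix n → Matrix n
  (X ⊗ Y) i j = sum (λ k → X i k * Y k j)

  _⊕_ : ∀ {n} → Matrix n → Matrix n → Matrix n
  (X ⊕ Y) i j = X i j + Y i j

  neg : ∀ {n} → Matrix n → Matrix n
  neg X i j = - X i j

  tr : ∀ {n} → Matrix n → Matrix n
  tr X i j = X j i

  𝟎 : ∀ {n} → Matrix n
  𝟎 i j = 0#

  𝐈 : ∀ {n} → Matrix n
  𝐈 = δ

  _≈_ : ∀ {n} → Matrix n → Matrix n → Set
  X ≈ Y = ∀ i j → X i j ≡ Y i j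

  ≈-refl : ∀ {n} {X : Matrix n} → X ≈ X
  ≈-refl i j = refl

  ≈-sym : ∀ {n} {X Y : Matrix n} → X ≈ Y → Y ≈ X
  ≈-sym e i j = sym (e i j)

  ≈-trans : ∀ {n} {X Y Z : Matrix n} → X ≈ Y → Y ≈ Z → X ≈ Z
  ≈-trans e f i j = trans (e i j) (f i j)

  ⊗-cong : ∀ {n} {X X′ Y Y′ : Matrix n} → X ≈ X′ → Y ≈ Y′ → X ⊗ Y ≈ X′ ⊗ Y′
  ⊗-cong e f i j = sum-cong-≗ (λ k → cong₂ _*_ (e i k) (f k j))

  ⊕-cong : ∀ {n} {X X′ Y Y′ : Matrix n} → X ≈ X′ → Y ≈ Y′ → X ⊕ Y ≈ X′ ⊕ Y′
  ⊕-cong e f i j = cong₂ _+_ (e i j) (f i j)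

  ⊗-assoc : ∀ {n} (X Y Z : Matrix n) → (X ⊗ Y) ⊗ Z ≈ X ⊗ (Y ⊗ Z)
  ⊗-assoc X Y Z i j = begin
    sum (λ k → sum (λ l → X i l * Y l k) * Z k j)
      ≡⟨ sum-cong-≗ (λ k → *-distribʳ-sum (Z k j) (λ l → X i l * Y l k)) ⟩
    sum (λ k → sum (λ l → X i l * Y l k * Z k j))
      ≡⟨ ∑-comm (λ k l → X i l * Y l k * Z k j) ⟩
    sum (λ l → sum (λ k → X i l * Y l k * Z k j))
      ≡⟨ sum-cong-≗ (λ l → trans (sum-cong-≗ (λ k → *-assoc (X i l) (Y l k) (Z k j)))
                                  (sym (*-distribˡ-sum (X i l) (λ k → Y l k * Z k j)))) ⟩
    sum (λ l → X i l * sum (λ k → Y l k * Z k j)) ∎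
    where open ≡-Reasoning

  ⊗-distribˡ-⊕ : ∀ {n} (X Y Z : Matrix n) → X ⊗ (Y ⊕ Z) ≈ X ⊗ Y ⊕ X ⊗ Z
  ⊗-distribˡ-⊕ {n} X Y Z i j =
    trans (sum-cong-≗ (λ k → distribˡ (X i k) (Y k j) (Z k j))) (∑-distrib-+ {n} _ _)

  ⊗-distribʳ-⊕ : ∀ {n} (X Y Z : Matrix n) → (Y ⊕ Z) ⊗ X ≈ Y ⊗ X ⊕ Z ⊗ X
  ⊗-distribʳ-⊕ {n} X Y Z i j =
    trans (sum-cong-≗ (λ k → distribʳ (X k j) (Y i k) (Z i k))) (∑-distrib-+ {n} _ _)

  ⊗-identityˡ : ∀ {n} (X : Matrix n) → 𝐈 ⊗ X ≈ X
  ⊗-identityˡ X i j = sum-δˡ i (λ k → X k j)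

  ⊗-identityʳ : ∀ {n} (X : Matrix n) → X ⊗ 𝐈 ≈ X
  ⊗-identityʳ X i j = sum-δʳ j (X i)

  ⊗-zeroˡ : ∀ {n} (X : Matrix n) → 𝟎 ⊗ X ≈ 𝟎
  ⊗-zeroˡ {n} X i j = trans (sum-cong-≗ (λ k → zeroˡ (X k j))) (sum-zero {n})

  ⊗-zeroʳ : ∀ {n} (X : Matrix n) → X ⊗ 𝟎 ≈ 𝟎
  ⊗-zeroʳ {n} X i j = trans (sum-cong-≗ (λ k → zeroʳ (X i k))) (sum-zero {n})

  neg-distribˡ-⊗ : ∀ {n} (X Y : Matrix n) → neg X ⊗ Y ≈ neg (X ⊗ Y)
  neg-distribˡ-⊗ {n} X Y i j =
    trans (sum-cong-≗ (λ k → sym (-‿distribˡ-* (X i k) (Y k j)))) (sum-neg {n} _)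

  neg-distribʳ-⊗ : ∀ {n} (X Y : Matrix n) → X ⊗ neg Y ≈ neg (X ⊗ Y)
  neg-distribʳ-⊗ {n} X Y i j =
    trans (sum-cong-≗ (λ k → sym (-‿distribʳ-* (X i k) (Y k j)))) (sum-neg {n} _)

  tr-⊗ : ∀ {n} (X Y : Matrix n) → tr (X ⊗ Y) ≈ tr Y ⊗ tr X
  tr-⊗ X Y i j = sum-cong-≗ (λ k → *-comm (X j k) (Y k i))

  tr-𝐈 : ∀ {n} → tr {n} 𝐈 ≈ 𝐈
  tr-𝐈 i j = δ-sym j i

  record Block (n : ℕ) : Set where
    constructor ⟦_,_,_,_⟧
    field
      A B C D : Matrix n
  open Block public

  infixl 7 _·_
  infix  4 _≈B_

  _·_ : ∀ {n} → Block n → Block n → Block n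
  M · N = ⟦ A M ⊗ A N ⊕ B M ⊗ C N , A M ⊗ B N ⊕ B M ⊗ D N
          , C M ⊗ A N ⊕ D M ⊗ C N , C M ⊗ B N ⊕ D M ⊗ D N ⟧

  trB : ∀ {n} → Block n → Block n
  trB M = ⟦ tr (A M) , tr (C M) , tr (B M) , tr (D M) ⟧

  negB : ∀ {n} → Block n → Block n
  negB M = ⟦ neg (A M) , neg (B M) , neg (C M) , neg (D M) ⟧

  _≈B_ : ∀ {n} → Block n → Block n → Set
  M ≈B N = (A M ≈ A N) × (B M ≈ B N) × (C M ≈ C N) × (D M ≈ D N)

  𝐈B : ∀ {n} → Block n
  𝐈B = ⟦ 𝐈 , 𝟎 , 𝟎 , 𝐈 ⟧

  J : ∀ {n} → Block n
  J = ⟦ 𝟎 , 𝐈 , neg 𝐈 , 𝟎 ⟧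

  Jᵀ : ∀ {n} → Block n
  Jᵀ = ⟦ 𝟎 , neg 𝐈 , 𝐈 , 𝟎 ⟧

  M₁ : ∀ {n} → Block n
  M₁ = ⟦ 𝐈 , 𝟎 , 𝐈 , 𝐈 ⟧

  ≈B-refl : ∀ {n} {M : Block n} → M ≈B M
  ≈B-refl = ≈-refl , ≈-refl , ≈-refl , ≈-refl

  ≈B-sym : ∀ {n} {M N : Block n} → M ≈B N → N ≈B M
  ≈B-sym (p , q , r , s) = ≈-sym p , ≈-sym q , ≈-sym r , ≈-sym s

  ≈B-trans : ∀ {n} {M N P : Block n} → M ≈B N → N ≈B P → M ≈B P
  ≈B-trans (p , q , r , s) (p′ , q′ , r′ , s′) =
    ≈-trans p p′ , ≈-trans q q′ , ≈-trans r r′ , ≈-trans s s′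

  blockSetoid : ℕ → Setoid 0ℓ 0ℓ
  blockSetoid n = record
    { Carrier       = Block n
    ; _≈_           = _≈B_
    ; isEquivalence = record { refl = ≈B-refl ; sym = ≈B-sym ; trans = ≈B-trans }
    }

  ·-cong : ∀ {n} {M M′ N N′ : Block n} → M ≈B M′ → N ≈B N′ → M · N ≈B M′ · N′
  ·-cong (p , q , r , s) (p′ , q′ , r′ , s′) =
    ⊕-cong (⊗-cong p p′) (⊗-cong q r′) , ⊕-cong (⊗-cong p q′) (⊗-cong q s′) ,
    ⊕-cong (⊗-cong r p′) (⊗-cong s r′) , ⊕-cong (⊗-cong r q′) (⊗-cong s s′)

  ·-congˡ : ∀ {n} (M : Block n) {N N′ : Block n} → N ≈B N′ → M · N ≈B M · N′
  ·-congˡ M = ·-cong ≈B-refl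

  ·-congʳ : ∀ {n} {M M′ : Block n} (N : Block n) → M ≈B M′ → M · N ≈B M′ · N
  ·-congʳ N e = ·-cong e ≈B-refl

  trB-cong : ∀ {n} {M M′ : Block n} → M ≈B M′ → trB M ≈B trB M′
  trB-cong (p , q , r , s) = (λ i j → p j i) , (λ i j → r j i) , (λ i j → q j i) , (λ i j → s j i)

  negB-cong : ∀ {n} {M M′ : Block n} → M ≈B M′ → negB M ≈B negB M′
  negB-cong (p , q , r , s) =
    (λ i j → cong -_ (p i j)) , (λ i j → cong -_ (q i j)) ,
    (λ i j → cong -_ (r i j)) , (λ i j → cong -_ (s i j))

  ·-assoc : ∀ {n} (M N P : Block n) → (M · N) · P ≈B M · (N · P)
  ·-assoc M N P =
    entry (A M) (B M) (A N) (C N) (B N) (D N) (A P) (C P) ,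
    entry (A M) (B M) (A N) (C N) (B N) (D N) (B P) (D P) ,
    entry (C M) (D M) (A N) (C N) (B N) (D N) (A P) (C P) ,
    entry (C M) (D M) (A N) (C N) (B N) (D N) (B P) (D P)
    where
    entry : ∀ (X Y U V U′ V′ S T : Matrix _) →
            (X ⊗ U ⊕ Y ⊗ V) ⊗ S ⊕ (X ⊗ U′ ⊕ Y ⊗ V′) ⊗ T ≈
            X ⊗ (U ⊗ S ⊕ U′ ⊗ T) ⊕ Y ⊗ (V ⊗ S ⊕ V′ ⊗ T)
    entry X Y U V U′ V′ S T i j = begin
      ((X ⊗ U ⊕ Y ⊗ V) ⊗ S) i j + ((X ⊗ U′ ⊕ Y ⊗ V′) ⊗ T) i j
        ≡⟨ cong₂ _+_ (⊗-distribʳ-⊕ S (X ⊗ U) (Y ⊗ V) i j) (⊗-distribʳ-⊕ T (X ⊗ U′) (Y ⊗ V′) i j) ⟩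
      (((X ⊗ U) ⊗ S) i j + ((Y ⊗ V) ⊗ S) i j) + (((X ⊗ U′) ⊗ T) i j + ((Y ⊗ V′) ⊗ T) i j)
        ≡⟨ +-interchange _ _ _ _ ⟩
      (((X ⊗ U) ⊗ S) i j + ((X ⊗ U′) ⊗ T) i j) + (((Y ⊗ V) ⊗ S) i j + ((Y ⊗ V′) ⊗ T) i j)
        ≡⟨ cong₂ _+_ (cong₂ _+_ (⊗-assoc X U S i j) (⊗-assoc X U′ T i j))
                     (cong₂ _+_ (⊗-assoc Y V S i j) (⊗-assoc Y V′ T i j)) ⟩
      ((X ⊗ (U ⊗ S)) i j + (X ⊗ (U′ ⊗ T)) i j) + ((Y ⊗ (V ⊗ S)) i j + (Y ⊗ (V′ ⊗ T)) i j)
        ≡⟨ sym (cong₂ _+_ (⊗-distribˡ-⊕ X (U ⊗ S) (U′ ⊗ T) i j) (⊗-distribˡ-⊕ Y (V ⊗ S) (V′ ⊗ T) i j)) ⟩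
      (X ⊗ (U ⊗ S ⊕ U′ ⊗ T)) i j + (Y ⊗ (V ⊗ S ⊕ V′ ⊗ T)) i j ∎
      where open ≡-Reasoning

  trB-· : ∀ {n} (M N : Block n) → trB (M · N) ≈B trB N · trB M
  trB-· M N = entry (A M) (A N) (B M) (C N) , entry (C M) (A N) (D M) (C N) ,
              entry (A M) (B N) (B M) (D N) , entry (C M) (B N) (D M) (D N)
    where
    entry : ∀ (X Y U V : Matrix _) → tr (X ⊗ Y ⊕ U ⊗ V) ≈ tr Y ⊗ tr X ⊕ tr V ⊗ tr U
    entry X Y U V i j = cong₂ _+_ (tr-⊗ X Y i j) (tr-⊗ U V i j)

  ·-identityˡ : ∀ {n} (M : Block n) → 𝐈B · M ≈B M
  ·-identityˡ M = entry₁ (A M) (C M) , entry₁ (B M) (D M) , entry₂ (A M) (C M) , entry₂ (B M) (D M)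
    where
    entry₁ : ∀ (X Y : Matrix _) → 𝐈 ⊗ X ⊕ 𝟎 ⊗ Y ≈ X
    entry₁ X Y i j = trans (cong₂ _+_ (⊗-identityˡ X i j) (⊗-zeroˡ Y i j)) (+-identityʳ _)
    entry₂ : ∀ (X Y : Matrix _) → 𝟎 ⊗ X ⊕ 𝐈 ⊗ Y ≈ Y
    entry₂ X Y i j = trans (cong₂ _+_ (⊗-zeroˡ X i j) (⊗-identityˡ Y i j)) (+-identityˡ _)

  ·-identityʳ : ∀ {n} (M : Block n) → M · 𝐈B ≈B M
  ·-identityʳ M = entry₁ (A M) (B M) , entry₂ (A M) (B M) , entry₁ (C M) (D M) , entry₂ (C M) (D M)
    where
    entry₁ : ∀ (X Y : Matrix _) → X ⊗ 𝐈 ⊕ Y ⊗ 𝟎 ≈ X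
    entry₁ X Y i j = trans (cong₂ _+_ (⊗-identityʳ X i j) (⊗-zeroʳ Y i j)) (+-identityʳ _)
    entry₂ : ∀ (X Y : Matrix _) → X ⊗ 𝟎 ⊕ Y ⊗ 𝐈 ≈ Y
    entry₂ X Y i j = trans (cong₂ _+_ (⊗-zeroʳ X i j) (⊗-identityʳ Y i j)) (+-identityˡ _)

  negB-distribˡ-· : ∀ {n} (M N : Block n) → negB M · N ≈B negB (M · N)
  negB-distribˡ-· M N = entry _ _ _ _ , entry _ _ _ _ , entry _ _ _ _ , entry _ _ _ _
    where
    entry : ∀ (X Y U V : Matrix _) → neg X ⊗ Y ⊕ neg U ⊗ V ≈ neg (X ⊗ Y ⊕ U ⊗ V)
    entry X Y U V i j = trans (cong₂ _+_ (neg-distribˡ-⊗ X Y i j) (neg-distribˡ-⊗ U V i j)) (-‿+-comm _ _)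

  negB-distribʳ-· : ∀ {n} (M N : Block n) → M · negB N ≈B negB (M · N)
  negB-distribʳ-· M N = entry _ _ _ _ , entry _ _ _ _ , entry _ _ _ _ , entry _ _ _ _
    where
    entry : ∀ (X Y U V : Matrix _) → X ⊗ neg Y ⊕ U ⊗ neg V ≈ neg (X ⊗ Y ⊕ U ⊗ V)
    entry X Y U V i j = trans (cong₂ _+_ (neg-distribʳ-⊗ X Y i j) (neg-distribʳ-⊗ U V i j)) (-‿+-comm _ _)

  neg𝐈⊗neg𝐈 : ∀ {n} → neg {n} 𝐈 ⊗ neg 𝐈 ≈ 𝐈
  neg𝐈⊗neg𝐈 i j = trans (neg-distribˡ-⊗ 𝐈 (neg 𝐈) i j)
                 (trans (cong -_ (neg-distribʳ-⊗ 𝐈 𝐈 i j))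
                 (trans (-‿involutive _) (⊗-identityˡ 𝐈 i j)))

  Jᵀ·J≈𝐈B : ∀ {n} → Jᵀ {n} · J ≈B 𝐈B
  Jᵀ·J≈𝐈B =
    (λ i j → trans (cong₂ _+_ (⊗-zeroˡ 𝟎 i j) (neg𝐈⊗neg𝐈 i j)) (+-identityˡ _)) ,
    (λ i j → trans (cong₂ _+_ (⊗-zeroˡ 𝐈 i j) (⊗-zeroʳ (neg 𝐈) i j)) (+-identityˡ _)) ,
    (λ i j → trans (cong₂ _+_ (⊗-zeroʳ 𝐈 i j) (⊗-zeroˡ (neg 𝐈) i j)) (+-identityˡ _)) ,
    (λ i j → trans (cong₂ _+_ (⊗-identityˡ 𝐈 i j) (⊗-zeroˡ 𝟎 i j)) (+-identityʳ _))

  J·Jᵀ≈𝐈B : ∀ {n} → J {n} · Jᵀ ≈B 𝐈B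
  J·Jᵀ≈𝐈B =
    (λ i j → trans (cong₂ _+_ (⊗-zeroˡ 𝟎 i j) (⊗-identityˡ 𝐈 i j)) (+-identityˡ _)) ,
    (λ i j → trans (cong₂ _+_ (⊗-zeroˡ (neg 𝐈) i j) (⊗-zeroʳ 𝐈 i j)) (+-identityˡ _)) ,
    (λ i j → trans (cong₂ _+_ (⊗-zeroʳ (neg 𝐈) i j) (⊗-zeroˡ 𝐈 i j)) (+-identityˡ _)) ,
    (λ i j → trans (cong₂ _+_ (neg𝐈⊗neg𝐈 i j) (⊗-zeroˡ 𝟎 i j)) (+-identityʳ _))

  trB-J : ∀ {n} → trB (J {n}) ≈B Jᵀ
  trB-J = ≈-refl , (λ i j → cong -_ (δ-sym j i)) , (λ i j → δ-sym j i) , ≈-refl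

  trB-Jᵀ : ∀ {n} → trB (Jᵀ {n}) ≈B J
  trB-Jᵀ = ≈-refl , (λ i j → δ-sym j i) , (λ i j → cong -_ (δ-sym j i)) , ≈-refl

  J≈negB-Jᵀ : ∀ {n} → J {n} ≈B negB Jᵀ
  J≈negB-Jᵀ = (λ i j → sym -0#≈0#) , (λ i j → sym (-‿involutive _)) , ≈-refl , (λ i j → sym -0#≈0#)

  Jᵀ≈negB-J : ∀ {n} → Jᵀ {n} ≈B negB J
  Jᵀ≈negB-J = (λ i j → sym -0#≈0#) , ≈-refl , (λ i j → sym (-‿involutive _)) , (λ i j → sym -0#≈0#)

  IsSp : ∀ {n} → Block n → Set
  IsSp γ = trB γ · J · γ ≈B J

  IsSpᵀ : ∀ {n} → Block n → Set
  IsSpᵀ γ = IsSp (trB γ)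

  sp⁻¹ : ∀ {n} → Block n → Block n
  sp⁻¹ γ = Jᵀ · trB γ · J

  module _ {n : ℕ} where
    open SetoidReasoning (blockSetoid n)

    private
      assoc⁻ : (M N P : Block n) → M · (N · P) ≈B (M · N) · P
      assoc⁻ M N P = ≈B-sym (·-assoc M N P)

    IsSp-cong : {M N : Block n} → M ≈B N → IsSp M → IsSp N
    IsSp-cong {M} {N} e s = begin
      trB N · J · N ≈⟨ ·-cong (·-congʳ J (trB-cong (≈B-sym e))) (≈B-sym e) ⟩
      trB M · J · M ≈⟨ s ⟩
      J             ∎

    IsSp-· : {M N : Block n} → IsSp M → IsSp N → IsSp (M · N)
    IsSp-· {M} {N} sM sN = begin
      trB (M · N) · J · (M · N)      ≈⟨ ·-congʳ (M · N) (·-congʳ J (trB-· M N)) ⟩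
      trB N · trB M · J · (M · N)    ≈⟨ assoc⁻ _ M N ⟩
      trB N · trB M · J · M · N      ≈⟨ ·-congʳ N (·-assoc (trB N · trB M) J M) ⟩
      trB N · trB M · (J · M) · N    ≈⟨ ·-congʳ N (·-assoc (trB N) (trB M) (J · M)) ⟩
      trB N · (trB M · (J · M)) · N  ≈⟨ ·-congʳ N (·-congˡ (trB N) (assoc⁻ (trB M) J M)) ⟩
      trB N · (trB M · J · M) · N    ≈⟨ ·-congʳ N (·-congˡ (trB N) sM) ⟩
      trB N · J · N                  ≈⟨ sN ⟩
      J                              ∎

    IsSpᵀ-· : {M N : Block n} → IsSpᵀ M → IsSpᵀ N → IsSpᵀ (M · N)
    IsSpᵀ-· {M} {N} sM sN = IsSp-cong (≈B-sym (trB-· M N)) (IsSp-· sN sM)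

    sp⁻¹-inverseˡ : {γ : Block n} → IsSp γ → sp⁻¹ γ · γ ≈B 𝐈B
    sp⁻¹-inverseˡ {γ} s = begin
      Jᵀ · trB γ · J · γ    ≈⟨ ·-assoc (Jᵀ · trB γ) J γ ⟩
      Jᵀ · trB γ · (J · γ)  ≈⟨ ·-assoc Jᵀ (trB γ) (J · γ) ⟩
      Jᵀ · (trB γ · (J · γ)) ≈⟨ ·-congˡ Jᵀ (assoc⁻ (trB γ) J γ) ⟩
      Jᵀ · (trB γ · J · γ)  ≈⟨ ·-congˡ Jᵀ s ⟩
      Jᵀ · J                ≈⟨ Jᵀ·J≈𝐈B ⟩
      𝐈B                    ∎

    IsSpᵀ⇒γJᵀγᵀ≈Jᵀ : {γ : Block n} → IsSpᵀ γ → γ · Jᵀ · trB γ ≈B Jᵀ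
    IsSpᵀ⇒γJᵀγᵀ≈Jᵀ {γ} s = begin
      γ · Jᵀ · trB γ         ≈⟨ ·-congʳ (trB γ) (·-congˡ γ Jᵀ≈negB-J) ⟩
      γ · negB J · trB γ     ≈⟨ ·-congʳ (trB γ) (negB-distribʳ-· γ J) ⟩
      negB (γ · J) · trB γ   ≈⟨ negB-distribˡ-· (γ · J) (trB γ) ⟩
      negB (γ · J · trB γ)   ≈⟨ negB-cong s ⟩
      negB J                 ≈⟨ ≈B-sym Jᵀ≈negB-J ⟩
      Jᵀ                     ∎

    sp⁻¹-inverseʳ : {γ : Block n} → IsSpᵀ γ → γ · sp⁻¹ γ ≈B 𝐈B
    sp⁻¹-inverseʳ {γ} s = begin
      γ · (Jᵀ · trB γ · J)   ≈⟨ assoc⁻ γ (Jᵀ · trB γ) J ⟩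
      γ · (Jᵀ · trB γ) · J   ≈⟨ ·-congʳ J (assoc⁻ γ Jᵀ (trB γ)) ⟩
      γ · Jᵀ · trB γ · J     ≈⟨ ·-congʳ J (IsSpᵀ⇒γJᵀγᵀ≈Jᵀ s) ⟩
      Jᵀ · J                 ≈⟨ Jᵀ·J≈𝐈B ⟩
      𝐈B                     ∎

    sp⁻¹-inverseʳ⇒IsSpᵀ : {γ : Block n} → γ · sp⁻¹ γ ≈B 𝐈B → IsSpᵀ γ
    sp⁻¹-inverseʳ⇒IsSpᵀ {γ} e = begin
      γ · J · trB γ          ≈⟨ ·-congʳ (trB γ) (·-congˡ γ J≈negB-Jᵀ) ⟩
      γ · negB Jᵀ · trB γ    ≈⟨ ·-congʳ (trB γ) (negB-distribʳ-· γ Jᵀ) ⟩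
      negB (γ · Jᵀ) · trB γ  ≈⟨ negB-distribˡ-· (γ · Jᵀ) (trB γ) ⟩
      negB (γ · Jᵀ · trB γ)  ≈⟨ negB-cong γJᵀγᵀ≈Jᵀ ⟩
      negB Jᵀ                ≈⟨ ≈B-sym J≈negB-Jᵀ ⟩
      J                      ∎
      where
      γJᵀγᵀ≈Jᵀ : γ · Jᵀ · trB γ ≈B Jᵀ
      γJᵀγᵀ≈Jᵀ = begin
        γ · Jᵀ · trB γ                ≈⟨ ·-identityʳ _ ⟨
        γ · Jᵀ · trB γ · 𝐈B           ≈⟨ ·-congˡ _ J·Jᵀ≈𝐈B ⟨
        γ · Jᵀ · trB γ · (J · Jᵀ)     ≈⟨ assoc⁻ _ J Jᵀ ⟩
        γ · Jᵀ · trB γ · J · Jᵀ       ≈⟨ ·-congʳ Jᵀ (·-congʳ J (·-assoc γ Jᵀ (trB γ))) ⟩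
        γ · (Jᵀ · trB γ) · J · Jᵀ     ≈⟨ ·-congʳ Jᵀ (·-assoc γ (Jᵀ · trB γ) J) ⟩
        γ · sp⁻¹ γ · Jᵀ               ≈⟨ ·-congʳ Jᵀ e ⟩
        𝐈B · Jᵀ                       ≈⟨ ·-identityˡ Jᵀ ⟩
        Jᵀ                            ∎

    IsSp-sp⁻¹ : {γ : Block n} → IsSpᵀ γ → IsSp (sp⁻¹ γ)
    IsSp-sp⁻¹ {γ} s = begin
      trB (Jᵀ · trB γ · J) · J · (Jᵀ · trB γ · J)
        ≈⟨ ·-congʳ (sp⁻¹ γ) (·-congʳ J trB-sp⁻¹) ⟩
      Jᵀ · γ · J · J · (Jᵀ · trB γ · J)
        ≈⟨ assoc⁻ _ (Jᵀ · trB γ) J ⟩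
      Jᵀ · γ · J · J · (Jᵀ · trB γ) · J
        ≈⟨ ·-congʳ J (assoc⁻ _ Jᵀ (trB γ)) ⟩
      Jᵀ · γ · J · J · Jᵀ · trB γ · J
        ≈⟨ ·-congʳ J (·-congʳ (trB γ) (·-assoc _ J Jᵀ)) ⟩
      Jᵀ · γ · J · (J · Jᵀ) · trB γ · J
        ≈⟨ ·-congʳ J (·-congʳ (trB γ) (·-congˡ _ J·Jᵀ≈𝐈B)) ⟩
      Jᵀ · γ · J · 𝐈B · trB γ · J
        ≈⟨ ·-congʳ J (·-congʳ (trB γ) (·-identityʳ _)) ⟩
      Jᵀ · γ · J · trB γ · J
        ≈⟨ ·-congʳ J (·-assoc _ J (trB γ)) ⟩
      Jᵀ · γ · (J · trB γ) · J
        ≈⟨ ·-congʳ J (·-assoc Jᵀ γ (J · trB γ)) ⟩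
      Jᵀ · (γ · (J · trB γ)) · J
        ≈⟨ ·-congʳ J (·-congˡ Jᵀ (assoc⁻ γ J (trB γ))) ⟩
      Jᵀ · (γ · J · trB γ) · J
        ≈⟨ ·-congʳ J (·-congˡ Jᵀ s) ⟩
      Jᵀ · J · J
        ≈⟨ ·-congʳ J Jᵀ·J≈𝐈B ⟩
      𝐈B · J
        ≈⟨ ·-identityˡ J ⟩
      J ∎
      where
      trB-sp⁻¹ : trB (Jᵀ · trB γ · J) ≈B Jᵀ · γ · J
      trB-sp⁻¹ = begin
        trB (Jᵀ · trB γ · J)        ≈⟨ trB-· (Jᵀ · trB γ) J ⟩
        trB J · trB (Jᵀ · trB γ)    ≈⟨ ·-congˡ (trB J) (trB-· Jᵀ (trB γ)) ⟩
        trB J · (γ · trB Jᵀ)        ≈⟨ ·-cong trB-J (·-congˡ γ trB-Jᵀ) ⟩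
        Jᵀ · (γ · J)                ≈⟨ assoc⁻ Jᵀ γ J ⟩
        Jᵀ · γ · J                  ∎

  γᵀJ : ∀ {n} → Block n → Block n
  γᵀJ γ = ⟦ neg (tr (C γ)) , tr (A γ) , neg (tr (D γ)) , tr (B γ) ⟧

  trB·J≈γᵀJ : ∀ {n} (γ : Block n) → trB γ · J ≈B γᵀJ γ
  trB·J≈γᵀJ γ = negEntry (tr (A γ)) (tr (C γ)) , idEntry (tr (A γ)) (tr (C γ)) ,
                negEntry (tr (B γ)) (tr (D γ)) , idEntry (tr (B γ)) (tr (D γ))
    where
    negEntry : ∀ (X Y : Matrix _) → X ⊗ 𝟎 ⊕ Y ⊗ neg 𝐈 ≈ neg Y
    negEntry X Y i j = trans (cong₂ _+_ (⊗-zeroʳ X i j)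
                                        (trans (neg-distribʳ-⊗ Y 𝐈 i j) (cong -_ (⊗-identityʳ Y i j))))
                             (+-identityˡ _)
    idEntry : ∀ (X Y : Matrix _) → X ⊗ 𝐈 ⊕ Y ⊗ 𝟎 ≈ X
    idEntry X Y i j = trans (cong₂ _+_ (⊗-identityʳ X i j) (⊗-zeroʳ Y i j)) (+-identityʳ _)

  IsSp⇒relations : ∀ {n} {γ : Block n} → IsSp γ → γᵀJ γ · γ ≈B J
  IsSp⇒relations {γ = γ} = ≈B-trans (·-congʳ γ (≈B-sym (trB·J≈γᵀJ γ)))

  relations⇒IsSp : ∀ {n} {γ : Block n} → γᵀJ γ · γ ≈B J → IsSp γ
  relations⇒IsSp {γ = γ} = ≈B-trans (·-congʳ γ (trB·J≈γᵀJ γ))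

  module _ {n : ℕ} where

    private
      ⊕-𝟎ˡ : {X Y Z : Matrix n} → X ≈ 𝟎 → Y ≈ Z → X ⊕ Y ≈ Z
      ⊕-𝟎ˡ e f i j = trans (cong₂ _+_ (e i j) (f i j)) (+-identityˡ _)

      ⊕-𝟎ʳ : {X Y Z : Matrix n} → X ≈ Z → Y ≈ 𝟎 → X ⊕ Y ≈ Z
      ⊕-𝟎ʳ e f i j = trans (cong₂ _+_ (e i j) (f i j)) (+-identityʳ _)

      ⊗-𝟎ˡ : {X : Matrix n} (Y : Matrix n) → X ≈ 𝟎 → X ⊗ Y ≈ 𝟎
      ⊗-𝟎ˡ Y e = ≈-trans (⊗-cong e ≈-refl) (⊗-zeroˡ Y)

      tr𝐈⊗ : (X : Matrix n) → tr 𝐈 ⊗ X ≈ X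
      tr𝐈⊗ X = ≈-trans (⊗-cong tr-𝐈 ≈-refl) (⊗-identityˡ X)

      negtr𝐈⊗ : (X : Matrix n) → neg (tr 𝐈) ⊗ X ≈ neg X
      negtr𝐈⊗ X = ≈-trans (neg-distribˡ-⊗ (tr 𝐈) X) (λ i j → cong -_ (tr𝐈⊗ X i j))

      neg𝟎≈𝟎 : neg (𝟎 {n}) ≈ 𝟎
      neg𝟎≈𝟎 i j = -0#≈0#

      neg⊕≈𝟎 : {X Y : Matrix n} → X ≈ Y → neg X ⊕ Y ≈ 𝟎
      neg⊕≈𝟎 e i j = trans (cong (λ t → - t + _) (e i j)) (-‿inverseˡ _)

    IsSp-upperShear : {S : Matrix n} → S ≈ tr S → IsSp ⟦ 𝐈 , S , 𝟎 , 𝐈 ⟧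
    IsSp-upperShear {S} S-sym = relations⇒IsSp
      ( ⊕-𝟎ˡ (⊗-𝟎ˡ 𝐈 neg𝟎≈𝟎) (⊗-zeroʳ (tr 𝐈))
      , ⊕-𝟎ˡ (⊗-𝟎ˡ S neg𝟎≈𝟎) (tr𝐈⊗ 𝐈)
      , ⊕-𝟎ʳ (negtr𝐈⊗ 𝐈) (⊗-zeroʳ (tr S))
      , ≈-trans (⊕-cong (negtr𝐈⊗ S) (⊗-identityʳ (tr S))) (neg⊕≈𝟎 S-sym) )

    IsSp-lowerShear : {S : Matrix n} → S ≈ tr S → IsSp ⟦ 𝐈 , 𝟎 , S , 𝐈 ⟧
    IsSp-lowerShear {S} S-sym = relations⇒IsSp
      ( ≈-trans (⊕-cong (≈-trans (neg-distribˡ-⊗ (tr S) 𝐈) (λ i j → cong -_ (⊗-identityʳ (tr S) i j)))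
                        (tr𝐈⊗ S))
                (neg⊕≈𝟎 (≈-sym S-sym))
      , ⊕-𝟎ˡ (⊗-zeroʳ (neg (tr S))) (tr𝐈⊗ 𝐈)
      , ⊕-𝟎ʳ (negtr𝐈⊗ 𝐈) (⊗-zeroˡ S)
      , ⊕-𝟎ˡ (⊗-zeroʳ (neg (tr 𝐈))) (⊗-zeroˡ 𝐈) )

    IsSp-diagonal : {P Q : Matrix n} → tr P ⊗ Q ≈ 𝐈 → IsSp ⟦ P , 𝟎 , 𝟎 , Q ⟧
    IsSp-diagonal {P} {Q} PᵀQ≈𝐈 = relations⇒IsSp
      ( ⊕-𝟎ˡ (⊗-𝟎ˡ P neg𝟎≈𝟎) (⊗-zeroʳ (tr P))
      , ⊕-𝟎ˡ (⊗-𝟎ˡ 𝟎 neg𝟎≈𝟎) PᵀQ≈𝐈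
      , ⊕-𝟎ʳ (≈-trans (neg-distribˡ-⊗ (tr Q) P) (λ i j → cong -_ (QᵀP≈𝐈 i j))) (⊗-zeroˡ 𝟎)
      , ⊕-𝟎ˡ (⊗-zeroʳ (neg (tr Q))) (⊗-zeroˡ Q) )
      where
      QᵀP≈𝐈 : tr Q ⊗ P ≈ 𝐈
      QᵀP≈𝐈 = ≈-trans (≈-sym (tr-⊗ (tr P) Q)) (≈-trans (λ i j → PᵀQ≈𝐈 j i) tr-𝐈)

    IsSpᵀ-upperShear : {S : Matrix n} → S ≈ tr S → IsSpᵀ ⟦ 𝐈 , S , 𝟎 , 𝐈 ⟧
    IsSpᵀ-upperShear S-sym =
      IsSp-cong (≈-sym tr-𝐈 , ≈-refl , S-sym , ≈-sym tr-𝐈) (IsSp-lowerShear S-sym)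

    IsSpᵀ-lowerShear : {S : Matrix n} → S ≈ tr S → IsSpᵀ ⟦ 𝐈 , 𝟎 , S , 𝐈 ⟧
    IsSpᵀ-lowerShear S-sym =
      IsSp-cong (≈-sym tr-𝐈 , S-sym , ≈-refl , ≈-sym tr-𝐈) (IsSp-upperShear S-sym)

    IsSpᵀ-diagonal : {P Q : Matrix n} → P ⊗ tr Q ≈ 𝐈 → IsSpᵀ ⟦ P , 𝟎 , 𝟎 , Q ⟧
    IsSpᵀ-diagonal = IsSp-diagonal

    IsSp-M₁ : IsSp (M₁ {n})
    IsSp-M₁ = IsSp-lowerShear (≈-sym tr-𝐈)

    IsSpᵀ-M₁ : IsSpᵀ (M₁ {n})
    IsSpᵀ-M₁ = IsSpᵀ-lowerShear (≈-sym tr-𝐈)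

    IsSp-𝐈B : IsSp (𝐈B {n})
    IsSp-𝐈B = IsSp-diagonal (tr𝐈⊗ 𝐈)

    IsSp-J : IsSp (J {n})
    IsSp-J = ≈B-trans (·-congʳ J (·-congʳ J trB-J)) (≈B-trans (·-congʳ J Jᵀ·J≈𝐈B) (·-identityˡ J))

  infixr 7 _▹_
  infixl 6 _+ᵥ_

  _▹_ : ∀ {n} → Matrix n → Vector R n → Vector R n
  (M ▹ v) i = sum (λ k → M i k * v k)

  _+ᵥ_ : ∀ {n} → Vector R n → Vector R n → Vector R n
  (u +ᵥ v) i = u i + v i

  0ᵥ : ∀ {n} → Vector R n
  0ᵥ _ = 0#

  dot : ∀ {n} → Vector R n → Vector R n → R
  dot u v = sum (λ i → u i * v i)

  diag : ∀ {n} → Matrix n → Vector R n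
  diag X i = X i i

  e : ∀ {n} → Fin n → Vector R n
  e j k = δ k j

  ▹-cong : ∀ {n} {X X′ : Matrix n} {u u′ : Vector R n} → X ≈ X′ → u ≗ u′ → X ▹ u ≗ X′ ▹ u′
  ▹-cong e f i = sum-cong-≗ (λ k → cong₂ _*_ (e i k) (f k))

  +ᵥ-cong : ∀ {n} {u u′ v v′ : Vector R n} → u ≗ u′ → v ≗ v′ → u +ᵥ v ≗ u′ +ᵥ v′
  +ᵥ-cong e f i = cong₂ _+_ (e i) (f i)

  ▹-assoc : ∀ {n} (X Y : Matrix n) (v : Vector R n) → (X ⊗ Y) ▹ v ≗ X ▹ Y ▹ v
  ▹-assoc X Y v i = begin
    sum (λ k → sum (λ l → X i l * Y l k) * v k)
      ≡⟨ sum-cong-≗ (λ k → *-distribʳ-sum (v k) (λ l → X i l * Y l k)) ⟩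
    sum (λ k → sum (λ l → X i l * Y l k * v k))
      ≡⟨ ∑-comm (λ k l → X i l * Y l k * v k) ⟩
    sum (λ l → sum (λ k → X i l * Y l k * v k))
      ≡⟨ sum-cong-≗ (λ l → trans (sum-cong-≗ (λ k → *-assoc (X i l) (Y l k) (v k)))
                                  (sym (*-distribˡ-sum (X i l) (λ k → Y l k * v k)))) ⟩
    sum (λ l → X i l * sum (λ k → Y l k * v k)) ∎
    where open ≡-Reasoning

  ▹-distribˡ-+ᵥ : ∀ {n} (X : Matrix n) (u v : Vector R n) → X ▹ (u +ᵥ v) ≗ X ▹ u +ᵥ X ▹ v
  ▹-distribˡ-+ᵥ {n} X u v i =
    trans (sum-cong-≗ (λ k → distribˡ (X i k) (u k) (v k))) (∑-distrib-+ {n} _ _)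

  ▹-distribʳ-⊕ : ∀ {n} (X Y : Matrix n) (v : Vector R n) → (X ⊕ Y) ▹ v ≗ X ▹ v +ᵥ Y ▹ v
  ▹-distribʳ-⊕ {n} X Y v i =
    trans (sum-cong-≗ (λ k → distribʳ (v k) (X i k) (Y i k))) (∑-distrib-+ {n} _ _)

  ▹-identityˡ : ∀ {n} (v : Vector R n) → 𝐈 ▹ v ≗ v
  ▹-identityˡ v i = sum-δˡ i v

  ▹-zeroˡ : ∀ {n} (v : Vector R n) → 𝟎 ▹ v ≗ 0ᵥ
  ▹-zeroˡ {n} v i = trans (sum-cong-≗ (λ k → zeroˡ (v k))) (sum-zero {n})

  ▹-zeroʳ : ∀ {n} (M : Matrix n) → M ▹ 0ᵥ ≗ 0ᵥ
  ▹-zeroʳ {n} M i = trans (sum-cong-≗ (λ k → zeroʳ (M i k))) (sum-zero {n})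

  ▹-e : ∀ {n} (M : Matrix n) (j : Fin n) → M ▹ e j ≗ λ i → M i j
  ▹-e M j i = sum-δʳ j (M i)

  dot-cong : ∀ {n} {u u′ v v′ : Vector R n} → u ≗ u′ → v ≗ v′ → dot u v ≡ dot u′ v′
  dot-cong e f = sum-cong-≗ (λ i → cong₂ _*_ (e i) (f i))

  dot-comm : ∀ {n} (u v : Vector R n) → dot u v ≡ dot v u
  dot-comm u v = sum-cong-≗ (λ i → *-comm (u i) (v i))

  dot-distribʳ-+ᵥ : ∀ {n} (u v w : Vector R n) → dot (u +ᵥ v) w ≡ dot u w + dot v w
  dot-distribʳ-+ᵥ {n} u v w = trans (sum-cong-≗ (λ i → distribʳ (w i) (u i) (v i))) (∑-distrib-+ {n} _ _)

  dot-distribˡ-+ᵥ : ∀ {n} (u v w : Vector R n) → dot u (v +ᵥ w) ≡ dot u v + dot u w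
  dot-distribˡ-+ᵥ {n} u v w = trans (sum-cong-≗ (λ i → distribˡ (u i) (v i) (w i))) (∑-distrib-+ {n} _ _)

  dot-zeroˡ : ∀ {n} (v : Vector R n) → dot 0ᵥ v ≡ 0#
  dot-zeroˡ {n} v = trans (sum-cong-≗ (λ i → zeroˡ (v i))) (sum-zero {n})

  dot-e : ∀ {n} (k : Fin n) (w : Vector R n) → dot (e k) w ≡ w k
  dot-e k w = trans (sum-cong-≗ (λ j → cong (_* w j) (δ-sym j k))) (sum-δˡ k w)

  dot-▹ : ∀ {n} (M : Matrix n) (u w : Vector R n) → dot (M ▹ u) w ≡ dot u (tr M ▹ w)
  dot-▹ M u w = begin
    sum (λ i → sum (λ k → M i k * u k) * w i)
      ≡⟨ sum-cong-≗ (λ i → *-distribʳ-sum (w i) (λ k → M i k * u k)) ⟩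
    sum (λ i → sum (λ k → M i k * u k * w i))
      ≡⟨ ∑-comm (λ i k → M i k * u k * w i) ⟩
    sum (λ k → sum (λ i → M i k * u k * w i))
      ≡⟨ sum-cong-≗ (λ k → trans (sum-cong-≗ (λ i → rearrange (M i k) (u k) (w i)))
                                  (sym (*-distribˡ-sum (u k) (λ i → M i k * w i)))) ⟩
    sum (λ k → u k * sum (λ i → M i k * w i)) ∎
    where
    open ≡-Reasoning
    rearrange : ∀ x y z → x * y * z ≡ y * (x * z)
    rearrange x y z = trans (cong (_* z) (*-comm x y)) (*-assoc y x z)

  BlockVector : ℕ → Set
  BlockVector n = Vector R n × Vector R n

  infix 4 _≋_
  _≋_ : ∀ {n} → BlockVector n → BlockVector n → Set
  u ≋ v = (proj₁ u ≗ proj₁ v) × (proj₂ u ≗ proj₂ v)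

  ≋-refl : ∀ {n} {v : BlockVector n} → v ≋ v
  ≋-refl = (λ _ → refl) , (λ _ → refl)

  ≋-sym : ∀ {n} {u v : BlockVector n} → u ≋ v → v ≋ u
  ≋-sym (e , f) = (λ i → sym (e i)) , (λ i → sym (f i))

  ≋-trans : ∀ {n} {u v w : BlockVector n} → u ≋ v → v ≋ w → u ≋ w
  ≋-trans (e , f) (e′ , f′) = (λ i → trans (e i) (e′ i)) , (λ i → trans (f i) (f′ i))

  act : ∀ {n} → Block n → BlockVector n → BlockVector n
  act γ (x , y) = A γ ▹ x +ᵥ B γ ▹ y , C γ ▹ x +ᵥ D γ ▹ y

  act-cong : ∀ {n} {γ γ′ : Block n} {v v′ : BlockVector n} → γ ≈B γ′ → v ≋ v′ → act γ v ≋ act γ′ v′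
  act-cong (p , q , r , s) (e , f) = +ᵥ-cong (▹-cong p e) (▹-cong q f) , +ᵥ-cong (▹-cong r e) (▹-cong s f)

  act-· : ∀ {n} (M N : Block n) (v : BlockVector n) → act (M · N) v ≋ act M (act N v)
  act-· M N (x , y) = entry (A M) (B M) (A N) (C N) (B N) (D N) , entry (C M) (D M) (A N) (C N) (B N) (D N)
    where
    entry : ∀ (X Y U V U′ V′ : Matrix _) →
            (X ⊗ U ⊕ Y ⊗ V) ▹ x +ᵥ (X ⊗ U′ ⊕ Y ⊗ V′) ▹ y ≗ X ▹ (U ▹ x +ᵥ U′ ▹ y) +ᵥ Y ▹ (V ▹ x +ᵥ V′ ▹ y)
    entry X Y U V U′ V′ i = begin
      ((X ⊗ U ⊕ Y ⊗ V) ▹ x) i + ((X ⊗ U′ ⊕ Y ⊗ V′) ▹ y) i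
        ≡⟨ cong₂ _+_ (▹-distribʳ-⊕ (X ⊗ U) (Y ⊗ V) x i) (▹-distribʳ-⊕ (X ⊗ U′) (Y ⊗ V′) y i) ⟩
      (((X ⊗ U) ▹ x) i + ((Y ⊗ V) ▹ x) i) + (((X ⊗ U′) ▹ y) i + ((Y ⊗ V′) ▹ y) i)
        ≡⟨ +-interchange _ _ _ _ ⟩
      (((X ⊗ U) ▹ x) i + ((X ⊗ U′) ▹ y) i) + (((Y ⊗ V) ▹ x) i + ((Y ⊗ V′) ▹ y) i)
        ≡⟨ cong₂ _+_ (cong₂ _+_ (▹-assoc X U x i) (▹-assoc X U′ y i))
                     (cong₂ _+_ (▹-assoc Y V x i) (▹-assoc Y V′ y i)) ⟩
      ((X ▹ U ▹ x) i + (X ▹ U′ ▹ y) i) + ((Y ▹ V ▹ x) i + (Y ▹ V′ ▹ y) i)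
        ≡⟨ sym (cong₂ _+_ (▹-distribˡ-+ᵥ X (U ▹ x) (U′ ▹ y) i) (▹-distribˡ-+ᵥ Y (V ▹ x) (V′ ▹ y) i)) ⟩
      (X ▹ (U ▹ x +ᵥ U′ ▹ y)) i + (Y ▹ (V ▹ x +ᵥ V′ ▹ y)) i ∎
      where open ≡-Reasoning

  act-𝐈B : ∀ {n} (v : BlockVector n) → act 𝐈B v ≋ v
  act-𝐈B (x , y) = (λ i → trans (cong₂ _+_ (▹-identityˡ x i) (▹-zeroˡ y i)) (+-identityʳ _))
                 , (λ i → trans (cong₂ _+_ (▹-zeroˡ x i) (▹-identityˡ y i)) (+-identityˡ _))

  act-zero : ∀ {n} (M : Block n) → act M (0ᵥ , 0ᵥ) ≋ (0ᵥ , 0ᵥ)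
  act-zero M = (λ i → trans (cong₂ _+_ (▹-zeroʳ (A M) i) (▹-zeroʳ (B M) i)) (+-identityˡ _))
             , (λ i → trans (cong₂ _+_ (▹-zeroʳ (C M) i) (▹-zeroʳ (D M) i)) (+-identityˡ _))

  act≋id⇒≈𝐈B : ∀ {n} (M : Block n) → (∀ v → act M v ≋ v) → M ≈B 𝐈B
  act≋id⇒≈𝐈B M h =
    (λ i j → trans (sym (column (A M) (B M) i j)) (proj₁ (h (e j , 0ᵥ)) i)) ,
    (λ i j → trans (sym (column′ (A M) (B M) i j)) (proj₁ (h (0ᵥ , e j)) i)) ,
    (λ i j → trans (sym (column (C M) (D M) i j)) (proj₂ (h (e j , 0ᵥ)) i)) ,
    (λ i j → trans (sym (column′ (C M) (D M) i j)) (proj₂ (h (0ᵥ , e j)) i))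
    where
    column : ∀ (X Y : Matrix _) i j → (X ▹ e j +ᵥ Y ▹ 0ᵥ) i ≡ X i j
    column X Y i j = trans (cong₂ _+_ (▹-e X j i) (▹-zeroʳ Y i)) (+-identityʳ _)
    column′ : ∀ (X Y : Matrix _) i j → (X ▹ 0ᵥ +ᵥ Y ▹ e j) i ≡ Y i j
    column′ X Y i j = trans (cong₂ _+_ (▹-zeroʳ X i) (▹-e Y j i)) (+-identityˡ _)

  outer : ∀ {n} → Vector R n → Vector R n → Matrix n
  outer u v i j = u i * v j

  outer-▹ : ∀ {n} (u v w : Vector R n) → outer u v ▹ w ≗ λ i → u i * dot v w
  outer-▹ {n} u v w i = trans (sum-cong-≗ (λ k → *-assoc (u i) (v k) (w k))) (sym (*-distribˡ-sum {n} (u i) _))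

  outer⊗outer : ∀ {n} (u v : Vector R n) → dot v u ≡ 0# → outer u v ⊗ outer u v ≈ 𝟎
  outer⊗outer {n} u v vu≡0 i j = begin
    sum (λ k → u i * v k * (u k * v j))
      ≡⟨ sum-cong-≗ (λ k → trans (*-assoc (u i) (v k) (u k * v j)) (cong (u i *_) (sym (*-assoc (v k) (u k) (v j))))) ⟩
    sum (λ k → u i * (v k * u k * v j))
      ≡⟨ sym (*-distribˡ-sum {n} (u i) _) ⟩
    u i * sum (λ k → v k * u k * v j)
      ≡⟨ cong (u i *_) (trans (sym (*-distribʳ-sum {n} (v j) _)) (trans (cong (_* v j) vu≡0) (zeroˡ (v j)))) ⟩
    u i * 0#
      ≡⟨ zeroʳ (u i) ⟩
    0# ∎
    where open ≡-Reasoning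

  square-zero⇒inverse : ∀ {n} {N : Matrix n} → N ⊗ N ≈ 𝟎 → (𝐈 ⊕ N) ⊗ (𝐈 ⊕ neg N) ≈ 𝐈
  square-zero⇒inverse {N = N} N²≈𝟎 i j = begin
    ((𝐈 ⊕ N) ⊗ (𝐈 ⊕ neg N)) i j
      ≡⟨ ⊗-distribʳ-⊕ (𝐈 ⊕ neg N) 𝐈 N i j ⟩
    (𝐈 ⊗ (𝐈 ⊕ neg N)) i j + (N ⊗ (𝐈 ⊕ neg N)) i j
      ≡⟨ cong₂ _+_ (⊗-identityˡ (𝐈 ⊕ neg N) i j) (⊗-distribˡ-⊕ N 𝐈 (neg N) i j) ⟩
    (δ i j + - N i j) + ((N ⊗ 𝐈) i j + (N ⊗ neg N) i j)
      ≡⟨ cong ((δ i j + - N i j) +_) (cong₂ _+_ (⊗-identityʳ N i j)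
           (trans (neg-distribʳ-⊗ N N i j) (trans (cong -_ (N²≈𝟎 i j)) -0#≈0#))) ⟩
    (δ i j + - N i j) + (N i j + 0#)
      ≡⟨ cong ((δ i j + - N i j) +_) (+-identityʳ (N i j)) ⟩
    (δ i j + - N i j) + N i j
      ≡⟨ +-assoc _ _ _ ⟩
    δ i j + (- N i j + N i j)
      ≡⟨ cong (δ i j +_) (-‿inverseˡ (N i j)) ⟩
    δ i j + 0#
      ≡⟨ +-identityʳ _ ⟩
    δ i j ∎
    where open ≡-Reasoning

  square-zero⇒inverse′ : ∀ {n} {N : Matrix n} → N ⊗ N ≈ 𝟎 → (𝐈 ⊕ neg N) ⊗ (𝐈 ⊕ N) ≈ 𝐈
  square-zero⇒inverse′ {N = N} N²≈𝟎 =
    ≈-trans (⊗-cong ≈-refl (⊕-cong ≈-refl (λ i j → sym (-‿involutive (N i j)))))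
            (square-zero⇒inverse negN²≈𝟎)
    where
    negN²≈𝟎 : neg N ⊗ neg N ≈ 𝟎
    negN²≈𝟎 i j = trans (neg-distribˡ-⊗ N (neg N) i j)
                 (trans (cong -_ (neg-distribʳ-⊗ N N i j))
                 (trans (-‿involutive _) (N²≈𝟎 i j)))

  ⊕-⊗-⊕ : ∀ {n} (W X Y Z : Matrix n) → (W ⊕ X) ⊗ (Y ⊕ Z) ≈ (W ⊗ Y ⊕ X ⊗ Z) ⊕ (W ⊗ Z ⊕ X ⊗ Y)
  ⊕-⊗-⊕ W X Y Z i j = begin
    ((W ⊕ X) ⊗ (Y ⊕ Z)) i j
      ≡⟨ ⊗-distribʳ-⊕ (Y ⊕ Z) W X i j ⟩
    (W ⊗ (Y ⊕ Z)) i j + (X ⊗ (Y ⊕ Z)) i j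
      ≡⟨ cong₂ _+_ (⊗-distribˡ-⊕ W Y Z i j) (⊗-distribˡ-⊕ X Y Z i j) ⟩
    ((W ⊗ Y) i j + (W ⊗ Z) i j) + ((X ⊗ Y) i j + (X ⊗ Z) i j)
      ≡⟨ cong (((W ⊗ Y) i j + (W ⊗ Z) i j) +_) (+-comm _ _) ⟩
    ((W ⊗ Y) i j + (W ⊗ Z) i j) + ((X ⊗ Z) i j + (X ⊗ Y) i j)
      ≡⟨ +-interchange _ _ _ _ ⟩
    ((W ⊗ Y) i j + (X ⊗ Z) i j) + ((W ⊗ Z) i j + (X ⊗ Y) i j) ∎
    where open ≡-Reasoning

  ⊗-⊗-reassoc : ∀ {n} (W X Y Z : Matrix n) → (W ⊗ X) ⊗ (Y ⊗ Z) ≈ W ⊗ ((X ⊗ Y) ⊗ Z)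
  ⊗-⊗-reassoc W X Y Z = ≈-trans (⊗-assoc W X (Y ⊗ Z)) (⊗-cong ≈-refl (≈-sym (⊗-assoc X Y Z)))

  tr-expansion : ∀ {n} (X Y Z W P Q : Matrix n) →
    tr (X ⊗ P ⊕ Y ⊗ Q) ⊗ (Z ⊗ P ⊕ W ⊗ Q) ≈
      (tr P ⊗ ((tr X ⊗ Z) ⊗ P) ⊕ tr Q ⊗ ((tr Y ⊗ W) ⊗ Q)) ⊕ (tr P ⊗ ((tr X ⊗ W) ⊗ Q) ⊕ tr Q ⊗ ((tr Y ⊗ Z) ⊗ P))
  tr-expansion X Y Z W P Q =
    ≈-trans (⊗-cong (⊕-cong (tr-⊗ X P) (tr-⊗ Y Q)) ≈-refl)
    (≈-trans (⊕-⊗-⊕ (tr P ⊗ tr X) (tr Q ⊗ tr Y) (Z ⊗ P) (W ⊗ Q))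
             (⊕-cong (⊕-cong (⊗-⊗-reassoc _ _ _ _) (⊗-⊗-reassoc _ _ _ _))
                     (⊕-cong (⊗-⊗-reassoc _ _ _ _) (⊗-⊗-reassoc _ _ _ _))))

  diagonal : ∀ {n} → Vector R n → Matrix n
  diagonal f i j = f i * δ i j

  diagonal-symmetric : ∀ {n} (f : Vector R n) → diagonal f ≈ tr (diagonal f)
  diagonal-symmetric f zero    zero    = refl
  diagonal-symmetric f zero    (suc j) = trans (zeroʳ _) (sym (zeroʳ _))
  diagonal-symmetric f (suc i) zero    = trans (zeroʳ _) (sym (zeroʳ _))
  diagonal-symmetric f (suc i) (suc j) = diagonal-symmetric (f ∘ suc) i j

  tr-outer-▹ : ∀ {n} (u v w : Vector R n) → tr (outer u v) ▹ w ≗ λ i → v i * dot u w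
  tr-outer-▹ {n} u v w i = begin
    sum (λ k → u k * v i * w k)   ≡⟨ sum-cong-≗ (λ k → trans (cong (_* w k) (*-comm (u k) (v i))) (*-assoc (v i) (u k) (w k))) ⟩
    sum (λ k → v i * (u k * w k)) ≡⟨ sym (*-distribˡ-sum {n} (v i) _) ⟩
    v i * dot u w                 ∎
    where open ≡-Reasoning

  δ-cases : ∀ {n} (i k : Fin n) → (i ≡ k) ⊎ (δ i k ≡ 0#)
  δ-cases zero    zero    = inj₁ refl
  δ-cases zero    (suc k) = inj₂ refl
  δ-cases (suc i) zero    = inj₂ refl
  δ-cases (suc i) (suc k) with δ-cases i k
  ... | inj₁ i≡k  = inj₁ (cong suc i≡k)
  ... | inj₂ δ≡0 = inj₂ δ≡0

  IsSpᵀ-𝐈B : ∀ {n} → IsSpᵀ (𝐈B {n})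
  IsSpᵀ-𝐈B = IsSpᵀ-diagonal (≈-trans (⊗-identityˡ (tr 𝐈)) tr-𝐈)

-- Finite setoids

private
  variable
    ℓ₁ ℓ₂ ℓ₃ ℓ₄ : Level
    𝒮 𝒯 : Setoid ℓ₁ ℓ₂

Fin-injective⇒surjective : ∀ {N} (f : Fin N → Fin N) → (∀ {i j} → f i ≡ f j → i ≡ j) → ∀ k → ∃ λ i → f i ≡ k
Fin-injective⇒surjective {suc m} f f-injective k with Finₚ.any? (λ i → f i Finₚ.≟ k)
... | yes found = found
... | no  ¬found = ⊥-elim (ℕₚ.<-irrefl refl (Finₚ.injective⇒≤ {f = g} g-injective))
  where
  k≢f : ∀ i → k ≢ f i
  k≢f i k≡fi = ¬found (i , sym k≡fi)
  g : Fin (suc m) → Fin m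
  g i = punchOut (k≢f i)
  g-injective : ∀ {i j} → g i ≡ g j → i ≡ j
  g-injective {i} {j} e = f-injective (Finₚ.punchOut-injective (k≢f i) (k≢f j) e)

Enumeration : Setoid ℓ₁ ℓ₂ → ℕ → Set _
Enumeration S N = Inverse (setoid (Fin N)) S

module Enumeration {S : Setoid ℓ₁ ℓ₂} {N : ℕ} (enum : Enumeration S N) where
  open Setoid S using (Carrier; _≈_) renaming (sym to ≈-sym; trans to ≈-trans; reflexive to ≈-reflexive)
  open Inverse enum public using () renaming (to to decode; from to encode; from-cong to encode-cong)

  decode-encode : ∀ x → decode (encode x) ≈ x
  decode-encode = Inverse.strictlyInverseˡ enum

  encode-decode : ∀ i → encode (decode i) ≡ i
  encode-decode = Inverse.strictlyInverseʳ enum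

  decode-injective : ∀ {i j} → decode i ≈ decode j → i ≡ j
  decode-injective {i} {j} e = trans (sym (encode-decode i)) (trans (encode-cong e) (encode-decode j))

  injective⇒surjective : (f : Carrier → Carrier) → (∀ {x y} → x ≈ y → f x ≈ f y) →
                          (∀ {x y} → f x ≈ f y → x ≈ y) → ∀ y → ∃ λ x → f x ≈ y
  injective⇒surjective f f-cong f-injective y with Fin-injective⇒surjective f̂ f̂-injective (encode y)
    where
    f̂ : Fin N → Fin N
    f̂ = encode ∘ f ∘ decode
    f̂-injective : ∀ {i j} → f̂ i ≡ f̂ j → i ≡ j
    f̂-injective e = decode-injective (f-injective (≈-trans (≈-sym (decode-encode _))
                                                  (≈-trans (≈-reflexive (cong decode e)) (decode-encode _))))
  ... | i , f̂i≡y = decode i , ≈-trans (≈-sym (decode-encode _)) (≈-trans (≈-reflexive (cong decode f̂i≡y)) (decode-encode y))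

infixr 2 _×ₑ_
_×ₑ_ : ∀ {m n} → Enumeration 𝒮 m → Enumeration 𝒯 n → Enumeration (𝒮 ×ₛ 𝒯) (m ℕ.* n)
e₁ ×ₑ e₂ = Compose.inverse (Compose.inverse Finₚ.*↔× (Symmetry.inverse Pointwise×.Pointwise-≡↔≡)) (e₁ ×-inverse e₂)

infixr 1 _⊎ₑ_
_⊎ₑ_ : ∀ {m n} → Enumeration 𝒮 m → Enumeration 𝒯 n → Enumeration (𝒮 ⊎ₛ 𝒯) (m ℕ.+ n)
_⊎ₑ_ {m = m} {n} e₁ e₂ =
  Compose.inverse (Compose.inverse Finₚ.+↔⊎ (Symmetry.inverse (Pointwise⊎.Pointwise-≡↔≡ (Fin m) (Fin n))))
                  (e₁ ⊎-inverse e₂)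

vectors : ∀ {A : Set} {k} → Enumeration (setoid A) k → ∀ n → Enumeration (Fin n →-setoid A) (k ℕ.^ n)
vectors {A = A} e zero    = record
  { to        = λ _ ()
  ; from      = λ _ → zero
  ; to-cong   = λ _ ()
  ; from-cong = λ _ → refl
  ; inverse   = (λ _ ()) , λ { {zero} _ → refl }
  }
vectors {A = A} e (suc n) = Compose.inverse (e ×ₑ vectors e n) cons
  where
  cons : Inverse (setoid A ×ₛ (Fin n →-setoid A)) (Fin (suc n) →-setoid A)
  cons = record
    { to        = λ (a , v) → a ∷ v
    ; from      = λ v → head v , tail v
    ; to-cong   = λ { (a≡b , v≗w) zero → a≡b ; (a≡b , v≗w) (suc i) → v≗w i }
    ; from-cong = λ v≗w → v≗w zero , v≗w ∘ suc
    ; inverse   = (λ { (a≡ , v≗) zero → a≡ ; (a≡ , v≗) (suc i) → v≗ i })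
                , (λ v≗ → v≗ zero , v≗ ∘ suc)
    }

module ℤΣ = SemiringSum ℤₚ.+-*-semiring

module _ {S : Setoid ℓ₁ ℓ₂} {N : ℕ} (enum : Enumeration S N) where
  open Setoid S using (Carrier; _≈_) renaming (sym to ≈-sym; trans to ≈-trans)
  open Enumeration enum

  ∑ : (Carrier → ℤ) → ℤ
  ∑ f = ℤΣ.sum (f ∘ decode)

  ∑-cong : ∀ {f g : Carrier → ℤ} → (∀ x → f x ≡ g x) → ∑ f ≡ ∑ g
  ∑-cong f≗g = ℤΣ.sum-cong-≗ (f≗g ∘ decode)

  ∑-*ˡ : ∀ c (f : Carrier → ℤ) → ∑ (λ x → c ℤ.* f x) ≡ c ℤ.* ∑ f
  ∑-*ˡ c f = sym (ℤΣ.*-distribˡ-sum {N} c (f ∘ decode))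

  ∑-invariant : (σ τ : Carrier → Carrier) → (∀ {x y} → x ≈ y → σ x ≈ σ y) → (∀ {x y} → x ≈ y → τ x ≈ τ y) →
                (∀ x → σ (τ x) ≈ x) → (∀ x → τ (σ x) ≈ x) →
                (f : Carrier → ℤ) → (∀ {x y} → x ≈ y → f x ≡ f y) → ∑ (f ∘ σ) ≡ ∑ f
  ∑-invariant σ τ σ-cong τ-cong στ τσ f f-cong = trans (ℤΣ.sum-cong-≗ reindex) (sym (ℤΣ.sum-permute (f ∘ decode) π))
    where
    σ̂ τ̂ : Fin N → Fin N
    σ̂ = encode ∘ σ ∘ decode
    τ̂ = encode ∘ τ ∘ decode
    σ̂τ̂ : ∀ i → σ̂ (τ̂ i) ≡ i
    σ̂τ̂ i = trans (encode-cong (≈-trans (σ-cong (decode-encode _)) (στ _))) (encode-decode i)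
    τ̂σ̂ : ∀ i → τ̂ (σ̂ i) ≡ i
    τ̂σ̂ i = trans (encode-cong (≈-trans (τ-cong (decode-encode _)) (τσ _))) (encode-decode i)
    π : Permutation N N
    π = permutation σ̂ τ̂ σ̂τ̂ τ̂σ̂
    reindex : ∀ i → f (σ (decode i)) ≡ f (decode (σ̂ i))
    reindex i = f-cong (≈-sym (decode-encode _))

sum-↑ : ∀ m {n} (g : Fin (m ℕ.+ n) → ℤ) → ℤΣ.sum g ≡ ℤΣ.sum (g ∘ (_↑ˡ n)) ℤ.+ ℤΣ.sum (g ∘ (m ↑ʳ_))
sum-↑ zero    g = sym (ℤₚ.+-identityˡ _)
sum-↑ (suc m) {n} g = trans (cong (ℤ._+_ (g zero)) (sum-↑ m (g ∘ suc)))
                              (sym (ℤₚ.+-assoc (g zero) (ℤΣ.sum (g ∘ suc ∘ (_↑ˡ n))) (ℤΣ.sum (g ∘ suc ∘ (m ↑ʳ_)))))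

sum-combine : ∀ m n (g : Fin (m ℕ.* n) → ℤ) → ℤΣ.sum g ≡ ℤΣ.sum (λ i → ℤΣ.sum (λ j → g (combine {m} {n} i j)))
sum-combine zero    n g = refl
sum-combine (suc m) n g = trans (sum-↑ n g) (cong (ℤ._+_ (ℤΣ.sum (λ j → g (j ↑ˡ (m ℕ.* n))))) (sum-combine m n (g ∘ (n ↑ʳ_))))

module _ {S : Setoid ℓ₁ ℓ₂} {T : Setoid ℓ₃ ℓ₄} {m n : ℕ} (e₁ : Enumeration S m) (e₂ : Enumeration T n) where
  open Setoid (S ×ₛ T) using (_≈_)

  ∑-× : (f : Setoid.Carrier (S ×ₛ T) → ℤ) → (∀ {x y} → x ≈ y → f x ≡ f y) →
        ∑ (e₁ ×ₑ e₂) f ≡ ∑ e₁ (λ x → ∑ e₂ (λ y → f (x , y)))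
  ∑-× f f-cong = trans (sum-combine m n _) (ℤΣ.sum-cong-≗ (λ i → ℤΣ.sum-cong-≗ (λ j → f-cong (decode-combine i j))))
    where
    decode-combine : ∀ i j → Enumeration.decode (e₁ ×ₑ e₂) (combine {m} {n} i j) ≈
                             (Enumeration.decode e₁ i , Enumeration.decode e₂ j)
    decode-combine i j = Inverse.to-cong (e₁ ×-inverse e₂) (Pointwise×.≡⇒≡×≡ (Finₚ.remQuot-combine i j))

∑-vectors : ∀ {A : Set} {k n} (e : Enumeration (setoid A) k) (F : (Fin (suc n) → A) → ℤ) →
            (∀ {u v} → u ≗ v → F u ≡ F v) →
            ∑ (vectors e (suc n)) F ≡ ∑ e (λ a → ∑ (vectors e n) (λ v → F (a ∷ v)))
∑-vectors {n = n} e F F-cong = ∑-× e (vectors e n) (λ (a , v) → F (a ∷ v)) F∷-cong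
  where
  F∷-cong : ∀ {x y} → Setoid._≈_ (setoid _ ×ₛ (Fin n →-setoid _)) x y → F (proj₁ x ∷ proj₂ x) ≡ F (proj₁ y ∷ proj₂ y)
  F∷-cong (a≡b , v≗w) = F-cong (λ { zero → a≡b ; (suc i) → v≗w i })

-- Characteristics over 𝔽₂

module F₂ where

  open Matrices ℙₚ.+-*-isCommutativeRing public

  x+x≡0 : ∀ x → x + x ≡ 0ℙ
  x+x≡0 = ℙₚ.p+p≡0ℙ

  x+y≡0⇒y≡x : ∀ {x y} → x + y ≡ 0ℙ → y ≡ x
  x+y≡0⇒y≡x {x} {y} x+y≡0 = begin
    y             ≡⟨ sym (+-identityˡ y) ⟩
    0ℙ + y        ≡⟨ cong (_+ y) (sym (x+x≡0 x)) ⟩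
    (x + x) + y   ≡⟨ +-assoc x x y ⟩
    x + (x + y)   ≡⟨ cong (x +_) x+y≡0 ⟩
    x + 0ℙ        ≡⟨ +-identityʳ x ⟩
    x             ∎
    where open ≡-Reasoning

  x+y≡z⇒y≡z+x : ∀ {x y z} → x + y ≡ z → y ≡ z + x
  x+y≡z⇒y≡z+x {x} {y} {z} x+y≡z = x+y≡0⇒y≡x (begin
    z + x + y     ≡⟨ +-assoc z x y ⟩
    z + (x + y)   ≡⟨ cong (z +_) x+y≡z ⟩
    z + z         ≡⟨ x+x≡0 z ⟩
    0ℙ            ∎)
    where open ≡-Reasoning

  quadratic-form : ∀ {n} (S : Matrix n) → S ≈ tr S → (x : Vector Parity n) →
                   sum (λ i → sum (λ j → x i * S i j * x j)) ≡ dot x (diag S)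
  quadratic-form {zero}  S S-sym x = refl
  quadratic-form {suc n} S S-sym x = begin
    (x₀ * S zero zero * x₀ + row) + sum (λ i → x (suc i) * S (suc i) zero * x₀ + rest i)
      ≡⟨ cong ((x₀ * S zero zero * x₀ + row) +_) (∑-distrib-+ {n} _ rest) ⟩
    (x₀ * S zero zero * x₀ + row) + (column + sum rest)
      ≡⟨ cong (λ t → (x₀ * S zero zero * x₀ + row) + (t + sum rest)) column≡row ⟩
    (x₀ * S zero zero * x₀ + row) + (row + sum rest)
      ≡⟨ +-assoc (x₀ * S zero zero * x₀) row (row + sum rest) ⟩
    x₀ * S zero zero * x₀ + (row + (row + sum rest))
      ≡⟨ cong (x₀ * S zero zero * x₀ +_) (sym (+-assoc row row (sum rest))) ⟩
    x₀ * S zero zero * x₀ + ((row + row) + sum rest)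
      ≡⟨ cong (λ t → x₀ * S zero zero * x₀ + (t + sum rest)) (x+x≡0 row) ⟩
    x₀ * S zero zero * x₀ + (0ℙ + sum rest)
      ≡⟨ cong₂ _+_ x₀Sx₀ (trans (+-identityˡ (sum rest))
                            (quadratic-form (λ i j → S (suc i) (suc j)) (λ i j → S-sym (suc i) (suc j)) (x ∘ suc))) ⟩
    x₀ * S zero zero + dot (x ∘ suc) (diag S ∘ suc) ∎
    where
    open ≡-Reasoning
    x₀ = x zero
    row = sum (λ j → x₀ * S zero (suc j) * x (suc j))
    rest = λ i → sum (λ j → x (suc i) * S (suc i) (suc j) * x (suc j))
    column = sum (λ i → x (suc i) * S (suc i) zero * x₀)
    column≡row : column ≡ row
    column≡row = sum-cong-≗ λ i → begin
      x (suc i) * S (suc i) zero * x₀   ≡⟨ cong (λ t → x (suc i) * t * x₀) (S-sym (suc i) zero) ⟩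
      x (suc i) * S zero (suc i) * x₀   ≡⟨ *-comm _ x₀ ⟩
      x₀ * (x (suc i) * S zero (suc i)) ≡⟨ cong (x₀ *_) (*-comm (x (suc i)) _) ⟩
      x₀ * (S zero (suc i) * x (suc i)) ≡⟨ sym (*-assoc x₀ _ _) ⟩
      x₀ * S zero (suc i) * x (suc i)   ∎
    x₀Sx₀ : x₀ * S zero zero * x₀ ≡ x₀ * S zero zero
    x₀Sx₀ = begin
      x₀ * S zero zero * x₀   ≡⟨ *-comm _ x₀ ⟩
      x₀ * (x₀ * S zero zero) ≡⟨ sym (*-assoc x₀ x₀ _) ⟩
      x₀ * x₀ * S zero zero   ≡⟨ cong (_* S zero zero) (ℙₚ.*-idem x₀) ⟩
      x₀ * S zero zero        ∎

  diag-congruence : ∀ {n} (S P : Matrix n) → S ≈ tr S → diag (tr P ⊗ (S ⊗ P)) ≗ tr P ▹ diag S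
  diag-congruence {n} S P S-sym i = begin
    sum (λ k → P k i * sum (λ l → S k l * P l i))
      ≡⟨ sum-cong-≗ {n} (λ k → trans (*-distribˡ-sum {n} (P k i) _) (sum-cong-≗ {n} (λ l → sym (*-assoc (P k i) _ _)))) ⟩
    sum (λ k → sum (λ l → P k i * S k l * P l i))
      ≡⟨ quadratic-form S S-sym (λ k → P k i) ⟩
    (tr P ▹ diag S) i ∎
    where open ≡-Reasoning

  χ : ∀ {n} → Block n → BlockVector n
  χ γ = diag (tr (A γ) ⊗ C γ) , diag (tr (B γ) ⊗ D γ)

  infixl 6 _⊞_
  _⊞_ : ∀ {n} → BlockVector n → BlockVector n → BlockVector n
  (x , y) ⊞ (x′ , y′) = x +ᵥ x′ , y +ᵥ y′

  χ-cong : ∀ {n} {M N : Block n} → M ≈B N → χ M ≋ χ N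
  χ-cong (p , q , r , s) = (λ i → ⊗-cong (λ k l → p l k) r i i) , (λ i → ⊗-cong (λ k l → q l k) s i i)

  module _ {n : ℕ} {X : Block n} (X-sp : IsSp X) where
    private
      relations : γᵀJ X · X ≈B J
      relations = IsSp⇒relations X-sp
      K = tr (C X) ⊗ B X

    AᵀC-symmetric : tr (A X) ⊗ C X ≈ tr (tr (A X) ⊗ C X)
    AᵀC-symmetric i j = trans (x+y≡0⇒y≡x (proj₁ relations i j)) (sym (tr-⊗ (tr (A X)) (C X) i j))

    BᵀD-symmetric : tr (B X) ⊗ D X ≈ tr (tr (B X) ⊗ D X)
    BᵀD-symmetric i j = trans (x+y≡0⇒y≡x (proj₂ (proj₂ (proj₂ relations)) i j)) (sym (tr-⊗ (tr (B X)) (D X) i j))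

    AᵀD≈𝐈⊕CᵀB : tr (A X) ⊗ D X ≈ 𝐈 ⊕ K
    AᵀD≈𝐈⊕CᵀB i j = x+y≡z⇒y≡z+x (proj₁ (proj₂ relations) i j)

    χ-·-component : (P Q : Matrix n) →
      diag (tr (A X ⊗ P ⊕ B X ⊗ Q) ⊗ (C X ⊗ P ⊕ D X ⊗ Q)) ≗
        tr P ▹ diag (tr (A X) ⊗ C X) +ᵥ tr Q ▹ diag (tr (B X) ⊗ D X) +ᵥ diag (tr P ⊗ Q)
    χ-·-component P Q i = begin
      (tr (A X ⊗ P ⊕ B X ⊗ Q) ⊗ (C X ⊗ P ⊕ D X ⊗ Q)) i i
        ≡⟨ tr-expansion (A X) (B X) (C X) (D X) P Q i i ⟩
      (T₁ i i + T₂ i i) + (T₃ i i + T₄ i i)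
        ≡⟨ cong₂ _+_ (cong₂ _+_ (diag-congruence _ P AᵀC-symmetric i) (diag-congruence _ Q BᵀD-symmetric i))
                     (cong₂ _+_ (T₃≈ i i) (T₄≈ i i)) ⟩
      (α′ + β′) + (((tr P ⊗ Q) i i + M i i) + M i i)
        ≡⟨ cong ((α′ + β′) +_) (trans (+-assoc ((tr P ⊗ Q) i i) (M i i) (M i i))
                                      (trans (cong ((tr P ⊗ Q) i i +_) (x+x≡0 (M i i))) (+-identityʳ _))) ⟩
      (α′ + β′) + (tr P ⊗ Q) i i ∎
      where
      open ≡-Reasoning
      T₁ = tr P ⊗ ((tr (A X) ⊗ C X) ⊗ P)
      T₂ = tr Q ⊗ ((tr (B X) ⊗ D X) ⊗ Q)
      T₃ = tr P ⊗ ((tr (A X) ⊗ D X) ⊗ Q)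
      T₄ = tr Q ⊗ ((tr (B X) ⊗ C X) ⊗ P)
      M  = tr P ⊗ (K ⊗ Q)
      α′ = (tr P ▹ diag (tr (A X) ⊗ C X)) i
      β′ = (tr Q ▹ diag (tr (B X) ⊗ D X)) i
      T₃≈ : T₃ ≈ tr P ⊗ Q ⊕ M
      T₃≈ = ≈-trans (⊗-cong ≈-refl (≈-trans (⊗-cong AᵀD≈𝐈⊕CᵀB ≈-refl)
                                   (≈-trans (⊗-distribʳ-⊕ Q 𝐈 K) (⊕-cong (⊗-identityˡ Q) ≈-refl))))
                    (⊗-distribˡ-⊕ (tr P) Q (K ⊗ Q))
      T₄≈ : T₄ ≈ tr M
      T₄≈ = ≈-trans (⊗-cong ≈-refl (⊗-cong (≈-sym (tr-⊗ (tr (C X)) (B X))) ≈-refl))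
            (≈-trans (≈-sym (⊗-assoc (tr Q) (tr K) P))
            (≈-trans (⊗-cong (≈-sym (tr-⊗ K Q)) ≈-refl)
                     (≈-sym (tr-⊗ (tr P) (K ⊗ Q)))))

    χ-· : (Y : Block n) → χ (X · Y) ≋ act (trB Y) (χ X) ⊞ χ Y
    χ-· Y = χ-·-component (A Y) (C Y) , χ-·-component (B Y) (D Y)

  0₂ : ∀ {n} → BlockVector n
  0₂ = 0ᵥ , 0ᵥ

  χ-J : ∀ {n} → χ (J {n}) ≋ 0₂
  χ-J = (λ i → ⊗-zeroˡ (neg 𝐈) i i) , (λ i → ⊗-zeroʳ (tr 𝐈) i i)

  χ-𝐈B : ∀ {n} → χ (𝐈B {n}) ≋ 0₂
  χ-𝐈B = (λ i → ⊗-zeroʳ (tr 𝐈) i i) , (λ i → ⊗-zeroˡ 𝐈 i i)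

  χ-·-invariant : ∀ {n} {X : Block n} → IsSp X → χ X ≋ 0₂ → ∀ Y → χ (X · Y) ≋ χ Y
  χ-·-invariant {X = X} X-sp χX≋0 Y = ≋-trans (χ-· X-sp Y)
    ((λ i → trans (cong (_+ proj₁ (χ Y) i) (proj₁ Yᵀχ≋0 i)) (+-identityˡ _)) ,
     (λ i → trans (cong (_+ proj₂ (χ Y) i) (proj₂ Yᵀχ≋0 i)) (+-identityˡ _)))
    where
    Yᵀχ≋0 : act (trB Y) (χ X) ≋ 0₂
    Yᵀχ≋0 = ≋-trans (act-cong (≈B-refl {M = trB Y}) χX≋0) (act-zero (trB Y))

  parities : Enumeration (setoid Parity) 2
  parities = record
    { to        = λ { zero → 0ℙ ; (suc zero) → 1ℙ }
    ; from      = λ { 0ℙ → zero ; 1ℙ → suc zero }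
    ; to-cong   = cong _
    ; from-cong = cong _
    ; inverse   = (λ { {0ℙ} refl → refl ; {1ℙ} refl → refl })
                , (λ { {zero} refl → refl ; {suc zero} refl → refl })
    }

  blockVectors : ∀ n → Enumeration ((Fin n →-setoid Parity) ×ₛ (Fin n →-setoid Parity)) _
  blockVectors n = vectors parities n ×ₑ vectors parities n

  module _ {n : ℕ} {γ : Block n} (γ-sp : IsSp γ) where

    act-sp⁻¹-act : ∀ v → act (sp⁻¹ γ) (act γ v) ≋ v
    act-sp⁻¹-act v = ≋-trans (≋-sym (act-· (sp⁻¹ γ) γ v)) (≋-trans (act-cong (sp⁻¹-inverseˡ γ-sp) ≋-refl) (act-𝐈B v))

    -- The left inverse sp⁻¹ γ is also a right inverse because 𝔽₂²ⁿ is finite.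
    act-surjective : ∀ v → ∃ λ w → act γ w ≋ v
    act-surjective = Enumeration.injective⇒surjective (blockVectors n) (act γ) (act-cong ≈B-refl)
      (λ {v} {w} e → ≋-trans (≋-sym (act-sp⁻¹-act v)) (≋-trans (act-cong ≈B-refl e) (act-sp⁻¹-act w)))

    act-act-sp⁻¹ : ∀ v → act γ (act (sp⁻¹ γ) v) ≋ v
    act-act-sp⁻¹ v = from-preimage (act-surjective v)
      where
      from-preimage : (∃ λ w → act γ w ≋ v) → act γ (act (sp⁻¹ γ) v) ≋ v
      from-preimage (w , γw≋v) = ≋-trans (act-cong ≈B-refl (act-cong ≈B-refl (≋-sym γw≋v)))
                                 (≋-trans (act-cong ≈B-refl (act-sp⁻¹-act w)) γw≋v)

    IsSp⇒IsSpᵀ : IsSpᵀ γ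
    IsSp⇒IsSpᵀ = sp⁻¹-inverseʳ⇒IsSpᵀ
      (act≋id⇒≈𝐈B (γ · sp⁻¹ γ) (λ v → ≋-trans (act-· γ (sp⁻¹ γ) v) (act-act-sp⁻¹ v)))

  χᵀ≋0⇒χ≋0 : ∀ {n} {h : Block n} → IsSp h → χ (trB h) ≋ 0₂ → χ h ≋ 0₂
  χᵀ≋0⇒χ≋0 {h = h} h-sp χhᵀ≋0 =
    ≋-trans (≋-sym (χ-·-invariant IsSp-J χ-J h))
    (≋-trans (≋-sym (χ-·-invariant (IsSp⇒IsSpᵀ h-sp) χhᵀ≋0 (J · h)))
    (≋-trans (χ-cong (≈B-trans (≈B-sym (·-assoc (trB h) J h)) h-sp)) χ-J))

  χ≋0⇒χᵀ≋0 : ∀ {n} {h : Block n} → IsSp h → χ h ≋ 0₂ → χ (trB h) ≋ 0₂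
  χ≋0⇒χᵀ≋0 h-sp = χᵀ≋0⇒χ≋0 (IsSp⇒IsSpᵀ h-sp)

  q : ∀ {n} → BlockVector n → Parity
  q (x , y) = dot x y

  ⟨_∣_⟩ : ∀ {n} → BlockVector n → BlockVector n → Parity
  ⟨ (α , β) ∣ (x , y) ⟩ = dot α x + dot β y

  q-cong : ∀ {n} {v w : BlockVector n} → v ≋ w → q v ≡ q w
  q-cong (e , f) = dot-cong e f

  dot-▹-▹ : ∀ {n} (M N : Matrix n) (u w : Vector Parity n) → dot (M ▹ u) (N ▹ w) ≡ dot u ((tr M ⊗ N) ▹ w)
  dot-▹-▹ M N u w = trans (dot-▹ M u (N ▹ w)) (dot-cong (λ _ → refl) (λ i → sym (▹-assoc (tr M) N w i)))

  dot-quadratic : ∀ {n} (S : Matrix n) → S ≈ tr S → (x : Vector Parity n) → dot x (S ▹ x) ≡ dot x (diag S)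
  dot-quadratic {n} S S-sym x =
    trans (sum-cong-≗ {n} (λ i → trans (*-distribˡ-sum {n} (x i) _) (sum-cong-≗ {n} (λ j → sym (*-assoc (x i) _ _)))))
          (quadratic-form S S-sym x)

  module _ {n : ℕ} {X : Block n} (X-sp : IsSp X) where

    q-act : ∀ v → q (act X v) ≡ q v + ⟨ χ X ∣ v ⟩
    q-act (x , y) = begin
      dot (A X ▹ x +ᵥ B X ▹ y) (C X ▹ x +ᵥ D X ▹ y)
        ≡⟨ dot-distribʳ-+ᵥ (A X ▹ x) (B X ▹ y) _ ⟩
      dot (A X ▹ x) (C X ▹ x +ᵥ D X ▹ y) + dot (B X ▹ y) (C X ▹ x +ᵥ D X ▹ y)
        ≡⟨ cong₂ _+_ (dot-distribˡ-+ᵥ (A X ▹ x) _ _) (dot-distribˡ-+ᵥ (B X ▹ y) _ _) ⟩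
      (dot (A X ▹ x) (C X ▹ x) + dot (A X ▹ x) (D X ▹ y)) + (dot (B X ▹ y) (C X ▹ x) + dot (B X ▹ y) (D X ▹ y))
        ≡⟨ cong₂ _+_ (cong₂ _+_ xSx xMy) (cong₂ _+_ yKx ySy) ⟩
      (a + (dot x y + k)) + (k + d)
        ≡⟨ cancel a (dot x y) k d ⟩
      dot x y + (a + d)
        ≡⟨ cong (dot x y +_) (cong₂ _+_ (dot-comm x _) (dot-comm y _)) ⟩
      dot x y + ⟨ χ X ∣ (x , y) ⟩ ∎
      where
      open ≡-Reasoning
      K = tr (C X) ⊗ B X
      a = dot x (diag (tr (A X) ⊗ C X))
      d = dot y (diag (tr (B X) ⊗ D X))
      k = dot x (K ▹ y)
      xSx : dot (A X ▹ x) (C X ▹ x) ≡ a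
      xSx = trans (dot-▹-▹ (A X) (C X) x x) (dot-quadratic _ (AᵀC-symmetric X-sp) x)
      ySy : dot (B X ▹ y) (D X ▹ y) ≡ d
      ySy = trans (dot-▹-▹ (B X) (D X) y y) (dot-quadratic _ (BᵀD-symmetric X-sp) y)
      xMy : dot (A X ▹ x) (D X ▹ y) ≡ dot x y + k
      xMy = trans (dot-▹-▹ (A X) (D X) x y)
            (trans (dot-cong (λ _ → refl) (λ i → trans (▹-cong (AᵀD≈𝐈⊕CᵀB X-sp) (λ _ → refl) i)
                                                  (trans (▹-distribʳ-⊕ 𝐈 K y i) (cong (_+ (K ▹ y) i) (▹-identityˡ y i)))))
                   (dot-distribˡ-+ᵥ x y (K ▹ y)))
      yKx : dot (B X ▹ y) (C X ▹ x) ≡ k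
      yKx = trans (dot-comm (B X ▹ y) (C X ▹ x)) (dot-▹-▹ (C X) (B X) x y)
      cancel : ∀ a b k d → (a + (b + k)) + (k + d) ≡ b + (a + d)
      cancel a b k d = begin
        (a + (b + k)) + (k + d)   ≡⟨ cong (_+ (k + d)) (sym (+-assoc a b k)) ⟩
        ((a + b) + k) + (k + d)   ≡⟨ +-assoc (a + b) k (k + d) ⟩
        (a + b) + (k + (k + d))   ≡⟨ cong ((a + b) +_) (sym (+-assoc k k d)) ⟩
        (a + b) + ((k + k) + d)   ≡⟨ cong (λ t → (a + b) + (t + d)) (x+x≡0 k) ⟩
        (a + b) + (0ℙ + d)        ≡⟨ cong ((a + b) +_) (+-identityˡ d) ⟩
        (a + b) + d               ≡⟨ cong (_+ d) (+-comm a b) ⟩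
        (b + a) + d               ≡⟨ +-assoc b a d ⟩
        b + (a + d)               ∎

  sgn : Parity → ℤ
  sgn 0ℙ = 1ℤ
  sgn 1ℙ = -[1+ 0 ]

  sgn-+ : ∀ p q → sgn (p + q) ≡ sgn p ℤ.* sgn q
  sgn-+ 0ℙ 0ℙ = refl
  sgn-+ 0ℙ 1ℙ = refl
  sgn-+ 1ℙ 0ℙ = refl
  sgn-+ 1ℙ 1ℙ = refl

  ∑-parities : (g : Parity → ℤ) → ∑ parities g ≡ g 0ℙ ℤ.+ g 1ℙ
  ∑-parities g = cong (ℤ._+_ (g 0ℙ)) (ℤₚ.+-identityʳ (g 1ℙ))

  gauss : ∀ {n} → (BlockVector n → Parity) → ℤ
  gauss {n} H = ∑ (blockVectors n) (sgn ∘ H)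

  affine : ∀ {n} → BlockVector n → BlockVector n → Parity
  affine ζ v = q v + ⟨ ζ ∣ v ⟩

  affine-cong : ∀ {n} (ζ : BlockVector n) {v w : BlockVector n} → v ≋ w → affine ζ v ≡ affine ζ w
  affine-cong (α , β) (e , f) = cong₂ _+_ (dot-cong e f) (cong₂ _+_ (dot-cong (λ _ → refl) e) (dot-cong (λ _ → refl) f))

  gauss-cons : ∀ {n} (H : BlockVector (suc n) → Parity) → (∀ {v w} → v ≋ w → H v ≡ H w) →
    gauss H ≡ ∑ parities (λ a → ∑ (vectors parities n) (λ x → ∑ parities (λ b → ∑ (vectors parities n) (λ y →
                sgn (H (a ∷ x , b ∷ y))))))
  gauss-cons {n} H H-cong = begin
    gauss H
      ≡⟨ ∑-× V V (sgn ∘ H) (cong sgn ∘ H-cong) ⟩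
    ∑ V (λ x → ∑ V (λ y → sgn (H (x , y))))
      ≡⟨ ∑-cong V (λ x → ∑-vectors parities (λ y → sgn (H (x , y)))
                                    (λ {u} {v} e → cong sgn (H-cong {x , u} {x , v} ((λ _ → refl) , e)))) ⟩
    ∑ V (λ x → ∑ parities (λ b → ∑ V′ (λ y → sgn (H (x , b ∷ y)))))
      ≡⟨ ∑-vectors parities _ (λ {x} {x̃} e → ∑-cong parities (λ b → ∑-cong V′ (λ y →
           cong sgn (H-cong {x , b ∷ y} {x̃ , b ∷ y} (e , λ _ → refl))))) ⟩
    ∑ parities (λ a → ∑ V′ (λ x → ∑ parities (λ b → ∑ V′ (λ y → sgn (H (a ∷ x , b ∷ y)))))) ∎
    where
    open ≡-Reasoning
    V = vectors parities (suc n)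
    V′ = vectors parities n

  sgn-affine-cons : ∀ {n} (α β : Vector Parity (suc n)) a b x y →
    sgn (affine (α , β) (a ∷ x , b ∷ y)) ≡ sgn (a * b + (α zero * a + β zero * b)) ℤ.* sgn (affine (α ∘ suc , β ∘ suc) (x , y))
  sgn-affine-cons α β a b x y =
    trans (cong sgn regroup) (sgn-+ (a * b + (α zero * a + β zero * b)) (affine (α ∘ suc , β ∘ suc) (x , y)))
    where
    regroup : (a * b + dot x y) + ((α zero * a + dot (α ∘ suc) x) + (β zero * b + dot (β ∘ suc) y)) ≡
              (a * b + (α zero * a + β zero * b)) + (dot x y + (dot (α ∘ suc) x + dot (β ∘ suc) y))
    regroup = trans (cong ((a * b + dot x y) +_) (+-interchange (α zero * a) (dot (α ∘ suc) x) (β zero * b) (dot (β ∘ suc) y)))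
                    (+-interchange (a * b) (dot x y) (α zero * a + β zero * b) (dot (α ∘ suc) x + dot (β ∘ suc) y))

  gauss-affine₁ : ∀ a b → (sgn (0ℙ * 0ℙ + (a * 0ℙ + b * 0ℙ)) ℤ.+ sgn (0ℙ * 1ℙ + (a * 0ℙ + b * 1ℙ))) ℤ.+
                          (sgn (1ℙ * 0ℙ + (a * 1ℙ + b * 0ℙ)) ℤ.+ sgn (1ℙ * 1ℙ + (a * 1ℙ + b * 1ℙ)))
                          ≡ ℤ.+ 2 ℤ.* sgn (a * b)
  gauss-affine₁ 0ℙ 0ℙ = refl
  gauss-affine₁ 0ℙ 1ℙ = refl
  gauss-affine₁ 1ℙ 0ℙ = refl
  gauss-affine₁ 1ℙ 1ℙ = refl

  gauss-affine : ∀ n (α β : Vector Parity n) → gauss (affine (α , β)) ≡ ℤ.+ (2 ^ n) ℤ.* sgn (dot α β)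
  gauss-affine zero    α β = refl
  gauss-affine (suc n) α β = begin
    gauss (affine (α , β))
      ≡⟨ gauss-cons (affine (α , β)) (affine-cong (α , β)) ⟩
    ∑ parities (λ a → ∑ V′ (λ x → ∑ parities (λ b → ∑ V′ (λ y → sgn (affine (α , β) (a ∷ x , b ∷ y))))))
      ≡⟨ ∑-cong parities (λ a → ∑-cong V′ (λ x → ∑-cong parities (λ b →
           trans (∑-cong V′ (sgn-affine-cons α β a b x)) (∑-*ˡ V′ (s a b) (λ y → G (x , y)))))) ⟩
    ∑ parities (λ a → ∑ V′ (λ x → ∑ parities (λ b → s a b ℤ.* R x)))
      ≡⟨ ∑-cong parities (λ a → trans (∑-cong V′ (λ x → trans (∑-parities (λ b → s a b ℤ.* R x))
                                                            (sym (ℤₚ.*-distribʳ-+ (R x) (s a 0ℙ) (s a 1ℙ)))))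
                                      (∑-*ˡ V′ (s a 0ℙ ℤ.+ s a 1ℙ) R)) ⟩
    ∑ parities (λ a → (s a 0ℙ ℤ.+ s a 1ℙ) ℤ.* ∑ V′ R)
      ≡⟨ trans (∑-parities (λ a → (s a 0ℙ ℤ.+ s a 1ℙ) ℤ.* ∑ V′ R))
               (sym (ℤₚ.*-distribʳ-+ (∑ V′ R) (s 0ℙ 0ℙ ℤ.+ s 0ℙ 1ℙ) (s 1ℙ 0ℙ ℤ.+ s 1ℙ 1ℙ))) ⟩
    ((s 0ℙ 0ℙ ℤ.+ s 0ℙ 1ℙ) ℤ.+ (s 1ℙ 0ℙ ℤ.+ s 1ℙ 1ℙ)) ℤ.* ∑ V′ R
      ≡⟨ cong₂ ℤ._*_ (gauss-affine₁ (α zero) (β zero))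
                     (trans (sym (∑-× V′ V′ G (cong sgn ∘ affine-cong (α ∘ suc , β ∘ suc))))
                            (gauss-affine n (α ∘ suc) (β ∘ suc))) ⟩
    (ℤ.+ 2 ℤ.* sgn (α zero * β zero)) ℤ.* (ℤ.+ (2 ^ n) ℤ.* sgn (dot (α ∘ suc) (β ∘ suc)))
      ≡⟨ ℤ*-interchange (ℤ.+ 2) (sgn (α zero * β zero)) (ℤ.+ (2 ^ n)) (sgn (dot (α ∘ suc) (β ∘ suc))) ⟩
    (ℤ.+ 2 ℤ.* ℤ.+ (2 ^ n)) ℤ.* (sgn (α zero * β zero) ℤ.* sgn (dot (α ∘ suc) (β ∘ suc)))
      ≡⟨ cong₂ ℤ._*_ (sym (ℤₚ.pos-* 2 (2 ^ n))) (sym (sgn-+ (α zero * β zero) (dot (α ∘ suc) (β ∘ suc)))) ⟩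
    ℤ.+ (2 ^ suc n) ℤ.* sgn (dot α β) ∎
    where
    open ≡-Reasoning
    V′ = vectors parities n
    G = sgn ∘ affine (α ∘ suc , β ∘ suc)
    s : Parity → Parity → ℤ
    s a b = sgn (a * b + (α zero * a + β zero * b))
    R : Vector Parity n → ℤ
    R x = ∑ V′ (λ y → G (x , y))

  gauss-invariant : ∀ {n} {γ : Block n} → IsSp γ → (H : BlockVector n → Parity) →
                    (∀ {v w} → v ≋ w → H v ≡ H w) → gauss (H ∘ act γ) ≡ gauss H
  gauss-invariant {n} {γ} γ-sp H H-cong =
    ∑-invariant (blockVectors n) (act γ) (act (sp⁻¹ γ)) (act-cong ≈B-refl) (act-cong ≈B-refl)
                (act-act-sp⁻¹ γ-sp) (act-sp⁻¹-act γ-sp) (sgn ∘ H) (cong sgn ∘ H-cong)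

  χ-even : ∀ {n} {γ : Block n} → IsSp γ → dot (proj₁ (χ γ)) (proj₂ (χ γ)) ≡ 0ℙ
  χ-even {n} {γ} γ-sp = sgn-injective (ℤₚ.*-cancelˡ-≡ (ℤ.+ (2 ^ n)) (sgn (dot α β)) (sgn 0ℙ) {{ℕₚ.m^n≢0 2 n}} (begin
    ℤ.+ (2 ^ n) ℤ.* sgn (dot α β)   ≡⟨ sym (gauss-affine n α β) ⟩
    gauss (affine (α , β))          ≡⟨ ∑-cong (blockVectors n) (λ v → cong sgn (sym (q-act γ-sp v))) ⟩
    gauss {n} (q ∘ act γ)           ≡⟨ gauss-invariant γ-sp q q-cong ⟩
    gauss {n} q                     ≡⟨ ∑-cong (blockVectors n) (λ v → cong sgn (q≡affine0 v)) ⟩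
    gauss {n} (affine 0₂)           ≡⟨ gauss-affine n (0ᵥ {n}) (0ᵥ {n}) ⟩
    ℤ.+ (2 ^ n) ℤ.* sgn (dot {n} 0ᵥ 0ᵥ) ≡⟨ cong (λ t → ℤ.+ (2 ^ n) ℤ.* sgn t) (dot-zeroˡ {n} 0ᵥ) ⟩
    ℤ.+ (2 ^ n) ℤ.* sgn 0ℙ          ∎))
    where
    open ≡-Reasoning
    α = proj₁ (χ γ)
    β = proj₂ (χ γ)
    q≡affine0 : ∀ v → q v ≡ affine 0₂ v
    q≡affine0 (x , y) = sym (trans (cong₂ (λ s t → dot x y + (s + t)) (dot-zeroˡ x) (dot-zeroˡ y)) (+-identityʳ _))
    sgn-injective : ∀ {p} → sgn p ≡ sgn 0ℙ → p ≡ 0ℙ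
    sgn-injective {0ℙ} _ = refl
    sgn-injective {1ℙ} ()

  1ᵥ : ∀ {n} → Vector Parity n
  1ᵥ _ = 1ℙ

  χ-M₁ : ∀ {n} → χ (M₁ {n}) ≋ (1ᵥ , 0ᵥ)
  χ-M₁ = (λ i → trans (⊗-cong tr-𝐈 (≈-refl {X = 𝐈}) i i) (trans (⊗-identityˡ 𝐈 i i) (δ-diag i))) , (λ i → ⊗-zeroˡ 𝐈 i i)

  χ-diagonalBlock : ∀ {n} (P Q : Matrix n) → χ ⟦ P , 𝟎 , 𝟎 , Q ⟧ ≋ 0₂
  χ-diagonalBlock P Q = (λ i → ⊗-zeroʳ (tr P) i i) , (λ i → ⊗-zeroˡ Q i i)

  χ-upperShear : ∀ {n} (S : Matrix n) → χ ⟦ 𝐈 , S , 𝟎 , 𝐈 ⟧ ≋ (0ᵥ , diag S)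
  χ-upperShear S = (λ i → ⊗-zeroʳ (tr 𝐈) i i) , (λ i → ⊗-identityʳ (tr S) i i)

  IsSp-lower-zero⇒Aᵀ-injective : ∀ {n} {d : Block n} → IsSp d → C d ≈ 𝟎 → ∀ v → tr (A d) ▹ v ≗ 0ᵥ → v ≗ 0ᵥ
  IsSp-lower-zero⇒Aᵀ-injective {n} {d} d-sp C≈𝟎 v Aᵀv≗0 i = begin
    v i                          ≡⟨ sym (▹-identityˡ v i) ⟩
    (𝐈 ▹ v) i                    ≡⟨ ▹-cong (≈-sym DAᵀ≈𝐈) (λ _ → refl) i ⟩
    ((D d ⊗ tr (A d)) ▹ v) i     ≡⟨ ▹-assoc (D d) (tr (A d)) v i ⟩
    (D d ▹ tr (A d) ▹ v) i       ≡⟨ ▹-cong (≈-refl {X = D d}) Aᵀv≗0 i ⟩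
    (D d ▹ 0ᵥ) i                 ≡⟨ ▹-zeroʳ (D d) i ⟩
    0ℙ                           ∎
    where
    open ≡-Reasoning
    ADᵀ≈𝐈 : A d ⊗ tr (D d) ≈ 𝐈
    ADᵀ≈𝐈 i j = trans (sym (trans (cong (_+ (A d ⊗ tr (D d)) i j) BCᵀ≡0) (+-identityˡ ((A d ⊗ tr (D d)) i j))))
                      (proj₁ (proj₂ (IsSp⇒relations (IsSp⇒IsSpᵀ d-sp))) i j)
      where
      BCᵀ≡0 : (tr (tr (B d)) ⊗ tr (C d)) i j ≡ 0ℙ
      BCᵀ≡0 = trans (⊗-cong (≈-refl {X = tr (tr (B d))}) (λ k l → C≈𝟎 l k) i j) (⊗-zeroʳ (tr (tr (B d))) i j)
    DAᵀ≈𝐈 : D d ⊗ tr (A d) ≈ 𝐈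
    DAᵀ≈𝐈 = ≈-trans (≈-sym (tr-⊗ (A d) (tr (D d)))) (≈-trans (λ i j → ADᵀ≈𝐈 j i) tr-𝐈)

  χ-M₁·diagonal·shear : ∀ {n} {P Q S : Matrix n} → IsSp ⟦ P , 𝟎 , 𝟎 , Q ⟧ →
    χ (M₁ · (⟦ P , 𝟎 , 𝟎 , Q ⟧ · ⟦ 𝐈 , S , 𝟎 , 𝐈 ⟧)) ≋ (tr P ▹ 1ᵥ , tr S ▹ tr P ▹ 1ᵥ +ᵥ diag S)
  χ-M₁·diagonal·shear {n} {P} {Q} {S} Dg-sp =
    ≋-trans (χ-· IsSp-M₁ X)
    (≋-trans ((λ i → cong₂ _+_ (proj₁ actX i) (proj₁ χX i)) , (λ i → cong₂ _+_ (proj₂ actX i) (proj₂ χX i)))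
             ((λ i → +-identityʳ ((tr P ▹ 1ᵥ) i)) , (λ i → cong (_+ diag S i) (+-identityʳ ((tr S ▹ tr P ▹ 1ᵥ) i)))))
    where
    Dg = ⟦ P , 𝟎 , 𝟎 , Q ⟧
    Sh = ⟦ 𝐈 , S , 𝟎 , 𝐈 ⟧
    X = Dg · Sh
    χX : χ X ≋ (0ᵥ , diag S)
    χX = ≋-trans (χ-·-invariant Dg-sp (χ-diagonalBlock P Q) Sh) (χ-upperShear S)
    actDg : act (trB Dg) (χ M₁) ≋ (tr P ▹ 1ᵥ , 0ᵥ)
    actDg = (λ i → trans (cong₂ _+_ (▹-cong (≈-refl {X = tr P}) (proj₁ χ-M₁) i) (▹-zeroˡ (proj₂ (χ M₁)) i))
                         (+-identityʳ ((tr P ▹ 1ᵥ) i)))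
          , (λ i → trans (cong₂ _+_ (▹-zeroˡ (proj₁ (χ M₁)) i) (▹-cong (≈-refl {X = tr Q}) (proj₂ χ-M₁) i))
                         (trans (+-identityˡ ((tr Q ▹ 0ᵥ) i)) (▹-zeroʳ (tr Q) i)))
    actSh : ∀ x → act (trB Sh) (x , 0ᵥ) ≋ (x , tr S ▹ x +ᵥ 0ᵥ)
    actSh x = (λ i → trans (cong₂ _+_ (trans (▹-cong tr-𝐈 (λ _ → refl) i) (▹-identityˡ x i)) (▹-zeroʳ (tr 𝟎) i)) (+-identityʳ _))
            , (λ i → cong ((tr S ▹ x) i +_) (▹-zeroʳ (tr 𝐈) i))
    actX : act (trB X) (χ M₁) ≋ (tr P ▹ 1ᵥ , tr S ▹ tr P ▹ 1ᵥ +ᵥ 0ᵥ)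
    actX = ≋-trans (act-cong (trB-· Dg Sh) ≋-refl)
           (≋-trans (act-· (trB Sh) (trB Dg) (χ M₁))
           (≋-trans (act-cong ≈B-refl actDg) (actSh (tr P ▹ 1ᵥ))))

  α-lower-zero : ∀ {n} {d : Block n} → C d ≈ 𝟎 → proj₁ (χ d) ≗ 0ᵥ
  α-lower-zero {d = d} C≈𝟎 i = trans (⊗-cong (≈-refl {X = tr (A d)}) C≈𝟎 i i) (⊗-zeroʳ (tr (A d)) i i)

  α-M₁·lower-zero : ∀ {n} {d : Block n} → C d ≈ 𝟎 → proj₁ (χ (M₁ · d)) ≗ tr (A d) ▹ 1ᵥ
  α-M₁·lower-zero {n} {d} C≈𝟎 i = begin
    proj₁ (χ (M₁ · d)) i
      ≡⟨ proj₁ (χ-· (IsSp-M₁ {n}) d) i ⟩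
    ((tr (A d) ▹ proj₁ (χ M₁)) i + (tr (C d) ▹ proj₂ (χ M₁)) i) + proj₁ (χ d) i
      ≡⟨ cong₂ _+_ (cong₂ _+_ (▹-cong (≈-refl {X = tr (A d)}) (proj₁ χ-M₁) i)
                              (trans (▹-cong (≈-refl {X = tr (C d)}) (proj₂ χ-M₁) i) (▹-zeroʳ (tr (C d)) i)))
                   (α-lower-zero {d = d} C≈𝟎 i) ⟩
    ((tr (A d) ▹ 1ᵥ) i + 0ℙ) + 0ℙ
      ≡⟨ trans (+-identityʳ _) (+-identityʳ _) ⟩
    (tr (A d) ▹ 1ᵥ) i ∎
    where open ≡-Reasoning

  IsEven : ∀ {n} → BlockVector n → Set
  IsEven (α , β) = dot α β ≡ 0ℙ

  HasPivot : ∀ {n} → Vector Parity n → Set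
  HasPivot α = ∃ λ k → α k ≡ 1ℙ

  Char₁ : ℕ → Set
  Char₁ n = Σ (BlockVector n) λ ζ → IsEven ζ × HasPivot (proj₁ ζ)

  blockVectorSetoid : ℕ → Setoid _ _
  blockVectorSetoid n = (Fin n →-setoid Parity) ×ₛ (Fin n →-setoid Parity)

  char₁Setoid : ℕ → Setoid _ _
  char₁Setoid n = On.setoid (blockVectorSetoid n) (proj₁ {B = λ ζ → IsEven ζ × HasPivot (proj₁ ζ)})

  private
    1≢0 : 1ℙ ≢ 0ℙ
    1≢0 ()

  -- Splitting off the first coordinates: α₀ = 1 leaves any (x, y) and forces β₀ = x · y, while α₀ = 0
  -- leaves β₀ free and (x, y) ∈ Char₁ n.
  module Char₁-split {n : ℕ} where
    open Setoid (blockVectorSetoid n ⊎ₛ (setoid Parity ×ₛ char₁Setoid n)) using () renaming (_≈_ to _≈₁_)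
    open Setoid (char₁Setoid (suc n)) using () renaming (_≈_ to _≈₂_)

    to : BlockVector n ⊎ (Parity × Char₁ n) → Char₁ (suc n)
    to (inj₁ (x , y))                         = (1ℙ ∷ x , dot x y ∷ y) , x+x≡0 (dot x y) , zero , refl
    to (inj₂ (b , ((x , y) , even , k , xₖ))) = (0ℙ ∷ x , b ∷ y) , even , suc k , xₖ

    split : (ζ : Char₁ (suc n)) (a : Parity) → head (proj₁ (proj₁ ζ)) ≡ a → BlockVector n ⊎ (Parity × Char₁ n)
    split ((α , β) , _    , _  ) 1ℙ _    = inj₁ (tail α , tail β)
    split ((α , β) , even , piv) 0ℙ α₀≡0 = inj₂ (head β , ((tail α , tail β) , even′ , tail-pivot piv))
      where
      even′ : dot (tail α) (tail β) ≡ 0ℙ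
      even′ = trans (cong (λ t → t * head β + dot (tail α) (tail β)) (sym α₀≡0)) even
      tail-pivot : HasPivot α → HasPivot (tail α)
      tail-pivot (zero  , α₀≡1) = ⊥-elim (1≢0 (trans (sym α₀≡1) α₀≡0))
      tail-pivot (suc k , αₖ≡1) = k , αₖ≡1

    from : Char₁ (suc n) → BlockVector n ⊎ (Parity × Char₁ n)
    from ζ = split ζ (head (proj₁ (proj₁ ζ))) refl

    to-cong : ∀ {y y′} → y ≈₁ y′ → to y ≈₂ to y′
    to-cong (inj₁ (x≗ , y≗)) = (λ { zero → refl ; (suc i) → x≗ i }) , (λ { zero → dot-cong x≗ y≗ ; (suc i) → y≗ i })
    to-cong (inj₂ (b≡ , (x≗ , y≗))) = (λ { zero → refl ; (suc i) → x≗ i }) , (λ { zero → b≡ ; (suc i) → y≗ i })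

    split-cong : ∀ {ζ ζ′} → ζ ≈₂ ζ′ → ∀ a b e e′ → split ζ a e ≈₁ split ζ′ b e′
    split-cong {(α , β) , _} {(α′ , β′) , _} (α≗ , β≗) 1ℙ 1ℙ _ _ = inj₁ (α≗ ∘ suc , β≗ ∘ suc)
    split-cong {(α , β) , _} {(α′ , β′) , _} (α≗ , β≗) 0ℙ 0ℙ _ _ = inj₂ (β≗ zero , (α≗ ∘ suc , β≗ ∘ suc))
    split-cong (α≗ , _) 1ℙ 0ℙ e e′ = ⊥-elim (1≢0 (trans (sym e) (trans (α≗ zero) e′)))
    split-cong (α≗ , _) 0ℙ 1ℙ e e′ = ⊥-elim (1≢0 (trans (sym e′) (trans (sym (α≗ zero)) e)))

    to-split : ∀ ζ a e {y} → y ≈₁ split ζ a e → to y ≈₂ ζ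
    to-split ((α , β) , even , _) 1ℙ α₀≡1 {inj₁ (x , y)} (inj₁ (x≗ , y≗)) =
      (λ { zero → sym α₀≡1 ; (suc i) → x≗ i }) ,
      (λ { zero → trans (dot-cong x≗ y≗) (x+y≡0⇒y≡x (trans (cong (λ t → t * head β + dot (tail α) (tail β)) (sym α₀≡1)) even))
         ; (suc i) → y≗ i })
    to-split ((α , β) , _) 0ℙ α₀≡0 {inj₂ (b , _)} (inj₂ (b≡ , (x≗ , y≗))) =
      (λ { zero → sym α₀≡0 ; (suc i) → x≗ i }) , (λ { zero → b≡ ; (suc i) → y≗ i })

    split-to : ∀ ζ a e y → ζ ≈₂ to y → split ζ a e ≈₁ y
    split-to ((α , β) , _) 1ℙ _ (inj₁ _) (α≗ , β≗) = inj₁ (α≗ ∘ suc , β≗ ∘ suc)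
    split-to ((α , β) , _) 0ℙ _ (inj₂ _) (α≗ , β≗) = inj₂ (β≗ zero , (α≗ ∘ suc , β≗ ∘ suc))
    split-to ζ 0ℙ e (inj₁ _) (α≗ , _) = ⊥-elim (1≢0 (trans (sym (α≗ zero)) e))
    split-to ζ 1ℙ e (inj₂ _) (α≗ , _) = ⊥-elim (1≢0 (trans (sym e) (α≗ zero)))

    inverse : Inverse (blockVectorSetoid n ⊎ₛ (setoid Parity ×ₛ char₁Setoid n)) (char₁Setoid (suc n))
    inverse = record
      { to        = to
      ; from      = from
      ; to-cong   = to-cong
      ; from-cong = λ {ζ} {ζ′} ζ≈ζ′ → split-cong ζ≈ζ′ _ _ refl refl
      ; inverse   = (λ {ζ} → to-split ζ _ refl) , (λ {y} {ζ} ζ≈ → split-to ζ _ refl y ζ≈)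
      }

  ∣Char₁∣ : ℕ → ℕ
  ∣Char₁∣ zero    = 0
  ∣Char₁∣ (suc n) = 2 ^ n ℕ.* 2 ^ n ℕ.+ 2 ℕ.* ∣Char₁∣ n

  char₁-enumeration : ∀ n → Enumeration (char₁Setoid n) (∣Char₁∣ n)
  char₁-enumeration zero    = record
    { to        = λ ()
    ; from      = λ { (_ , _ , () , _) }
    ; to-cong   = λ { {()} }
    ; from-cong = λ { {_ , _ , () , _} }
    ; inverse   = (λ { {_ , _ , () , _} }) , (λ { {()} })
    }
  char₁-enumeration (suc n) = Compose.inverse (blockVectors n ⊎ₑ (parities ×ₑ char₁-enumeration n)) Char₁-split.inverse

  ∣Char₁∣+2ⁿ≡2ⁿ*2ⁿ⁺¹ : ∀ n → ∣Char₁∣ (suc n) ℕ.+ 2 ^ n ≡ 2 ^ n ℕ.* 2 ^ suc n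
  ∣Char₁∣+2ⁿ≡2ⁿ*2ⁿ⁺¹ zero    = refl
  ∣Char₁∣+2ⁿ≡2ⁿ*2ⁿ⁺¹ (suc n) = begin
    (P₂ ℕ.* P₂ ℕ.+ 2 ℕ.* X) ℕ.+ P₂
      ≡⟨ solve 3 (λ P₂ X P → (P₂ :* P₂ :+ con 2 :* X) :+ (con 2 :* P) := P₂ :* P₂ :+ con 2 :* (X :+ P)) refl P₂ X P ⟩
    P₂ ℕ.* P₂ ℕ.+ 2 ℕ.* (X ℕ.+ P)
      ≡⟨ cong (λ t → P₂ ℕ.* P₂ ℕ.+ 2 ℕ.* t) (∣Char₁∣+2ⁿ≡2ⁿ*2ⁿ⁺¹ n) ⟩
    P₂ ℕ.* P₂ ℕ.+ 2 ℕ.* (P ℕ.* P₂)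
      ≡⟨ solve 1 (λ P → (con 2 :* P) :* (con 2 :* P) :+ con 2 :* (P :* (con 2 :* P)) := (con 2 :* P) :* (con 2 :* (con 2 :* P)))
                 refl P ⟩
    P₂ ℕ.* (2 ℕ.* P₂) ∎
    where
    open ≡-Reasoning
    open +-*-Solver
    P = 2 ^ n
    P₂ = 2 ^ suc n
    X = ∣Char₁∣ (suc n)

  ∣Char₁∣-closed-form : ∀ n → ∣Char₁∣ (suc n) ≡ 2 ^ n ℕ.* (2 ^ suc n ∸ 1)
  ∣Char₁∣-closed-form n = begin
    ∣Char₁∣ (suc n)                                   ≡⟨ sym (ℕₚ.m+n∸n≡m (∣Char₁∣ (suc n)) (2 ^ n)) ⟩
    ∣Char₁∣ (suc n) ℕ.+ 2 ^ n ∸ 2 ^ n                 ≡⟨ cong (_∸ 2 ^ n) (∣Char₁∣+2ⁿ≡2ⁿ*2ⁿ⁺¹ n) ⟩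
    2 ^ n ℕ.* 2 ^ suc n ∸ 2 ^ n                 ≡⟨ cong (2 ^ n ℕ.* 2 ^ suc n ∸_) (sym (ℕₚ.*-identityʳ (2 ^ n))) ⟩
    2 ^ n ℕ.* 2 ^ suc n ∸ 2 ^ n ℕ.* 1           ≡⟨ sym (ℕₚ.*-distribˡ-∸ (2 ^ n) (2 ^ suc n) 1) ⟩
    2 ^ n ℕ.* (2 ^ suc n ∸ 1)                   ∎
    where open ≡-Reasoning

-- Reduction modulo 2

parityℤ : ℤ → Parity
parityℤ i = ℕ.parity ∣ i ∣

parityℤ-⊖ : ∀ m n → parityℤ (m ℤ.⊖ n) ≡ ℕ.parity (m ℕ.+ n)
parityℤ-⊖ m       zero    = trans (cong parityℤ (ℤₚ.⊖-≥ {m} {0} ℕ.z≤n)) (cong ℕ.parity (sym (ℕₚ.+-identityʳ m)))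
parityℤ-⊖ zero    (suc n) = refl
parityℤ-⊖ (suc m) (suc n) = trans (cong parityℤ (ℤₚ.[1+m]⊖[1+n]≡m⊖n m n))
                           (trans (parityℤ-⊖ m n) (cong (ℕ.parity ∘ suc) (sym (ℕₚ.+-suc m n))))

parityℤ-+ : ∀ i j → parityℤ (i ℤ.+ j) ≡ parityℤ i ℙ.+ parityℤ j
parityℤ-+ (ℤ.+ m)  (ℤ.+ n)  = ℙₚ.+-homo-+ m n
parityℤ-+ (ℤ.+ m)  -[1+ n ] = trans (parityℤ-⊖ m (suc n)) (ℙₚ.+-homo-+ m (suc n))
parityℤ-+ -[1+ m ] (ℤ.+ n)  = trans (parityℤ-⊖ n (suc m))
                             (trans (ℙₚ.+-homo-+ n (suc m)) (ℙₚ.+-comm (ℕ.parity n) (ℕ.parity (suc m))))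
parityℤ-+ -[1+ m ] -[1+ n ] = trans (cong (ℕ.parity ∘ suc) (sym (ℕₚ.+-suc m n))) (ℙₚ.+-homo-+ (suc m) (suc n))

parityℤ-* : ∀ i j → parityℤ (i ℤ.* j) ≡ parityℤ i ℙ.* parityℤ j
parityℤ-* i j = trans (cong ℕ.parity (ℤₚ.abs-* i j)) (ℙₚ.*-homo-* ∣ i ∣ ∣ j ∣)

parityℤ-neg : ∀ i → parityℤ (ℤ.- i) ≡ parityℤ i
parityℤ-neg i = cong ℕ.parity (ℤₚ.∣-i∣≡∣i∣ i)

2∣⇒parity≡0 : ∀ {n} → 2 ℕ∣.∣ n → ℕ.parity n ≡ 0ℙ
2∣⇒parity≡0 (divides q refl) = trans (ℙₚ.*-homo-* q 2) (ℙₚ.*-zeroʳ (ℕ.parity q))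

parity≡0⇒2∣ : ∀ n → ℕ.parity n ≡ 0ℙ → 2 ℕ∣.∣ n
parity≡0⇒2∣ zero          _  = divides 0 refl
parity≡0⇒2∣ (suc (suc n)) eq with parity≡0⇒2∣ n eq
... | divides q n≡q*2 = divides (suc q) (cong (λ m → suc (suc m)) n≡q*2)

liftℤ : Parity → ℤ
liftℤ 0ℙ = ℤ.0ℤ
liftℤ 1ℙ = ℤ.1ℤ

parityℤ-liftℤ : ∀ p → parityℤ (liftℤ p) ≡ p
parityℤ-liftℤ 0ℙ = refl
parityℤ-liftℤ 1ℙ = refl

module ℤᴹ = Matrices ℤₚ.+-*-isCommutativeRing

module Reduction where
  open F₂

  parityℤ-sum : ∀ {n} (f : Fin n → ℤ) → parityℤ (ℤᴹ.sum f) ≡ sum (parityℤ ∘ f)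
  parityℤ-sum {zero}  f = refl
  parityℤ-sum {suc n} f = trans (parityℤ-+ (f zero) (ℤᴹ.sum (f ∘ suc))) (cong (parityℤ (f zero) ℙ.+_) (parityℤ-sum (f ∘ suc)))

  parityℤ-δ : ∀ {n} (i j : Fin n) → parityℤ (ℤᴹ.δ i j) ≡ δ i j
  parityℤ-δ zero    zero    = refl
  parityℤ-δ zero    (suc j) = refl
  parityℤ-δ (suc i) zero    = refl
  parityℤ-δ (suc i) (suc j) = parityℤ-δ i j

  reduce : ∀ {n} → ℤᴹ.Matrix n → Matrix n
  reduce X i j = parityℤ (X i j)

  reduceB : ∀ {n} → ℤᴹ.Block n → Block n
  reduceB M = ⟦ reduce (ℤᴹ.A M) , reduce (ℤᴹ.B M) , reduce (ℤᴹ.C M) , reduce (ℤᴹ.D M) ⟧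

  reduce-𝐈 : ∀ {n} → reduce (ℤᴹ.𝐈 {n}) ≈ 𝐈
  reduce-𝐈 = parityℤ-δ

  reduce-⊗⊕⊗ : ∀ {n} (X Y Z W : ℤᴹ.Matrix n) →
    reduce (X ℤᴹ.⊗ Y ℤᴹ.⊕ Z ℤᴹ.⊗ W) ≈ reduce X ⊗ reduce Y ⊕ reduce Z ⊗ reduce W
  reduce-⊗⊕⊗ {n} X Y Z W i j = trans (parityℤ-+ ((X ℤᴹ.⊗ Y) i j) ((Z ℤᴹ.⊗ W) i j)) (cong₂ ℙ._+_ (reduce-⊗ X Y) (reduce-⊗ Z W))
    where
    reduce-⊗ : ∀ (X Y : ℤᴹ.Matrix n) → parityℤ ((X ℤᴹ.⊗ Y) i j) ≡ (reduce X ⊗ reduce Y) i j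
    reduce-⊗ X Y = trans (parityℤ-sum (λ k → X i k ℤ.* Y k j)) (sum-cong-≗ {n} (λ k → parityℤ-* (X i k) (Y k j)))

  reduceB-· : ∀ {n} (M N : ℤᴹ.Block n) → reduceB (M ℤᴹ.· N) ≈B reduceB M · reduceB N
  reduceB-· M N =
    reduce-⊗⊕⊗ (ℤᴹ.A M) (ℤᴹ.A N) (ℤᴹ.B M) (ℤᴹ.C N) , reduce-⊗⊕⊗ (ℤᴹ.A M) (ℤᴹ.B N) (ℤᴹ.B M) (ℤᴹ.D N) ,
    reduce-⊗⊕⊗ (ℤᴹ.C M) (ℤᴹ.A N) (ℤᴹ.D M) (ℤᴹ.C N) , reduce-⊗⊕⊗ (ℤᴹ.C M) (ℤᴹ.B N) (ℤᴹ.D M) (ℤᴹ.D N)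

  reduceB-cong : ∀ {n} {M N : ℤᴹ.Block n} → M ℤᴹ.≈B N → reduceB M ≈B reduceB N
  reduceB-cong (p , q , r , s) =
    (λ i j → cong parityℤ (p i j)) , (λ i j → cong parityℤ (q i j)) ,
    (λ i j → cong parityℤ (r i j)) , (λ i j → cong parityℤ (s i j))

  reduceB-J : ∀ {n} → reduceB (ℤᴹ.J {n}) ≈B J
  reduceB-J = ≈-refl , parityℤ-δ , (λ i j → trans (parityℤ-neg (ℤᴹ.δ i j)) (parityℤ-δ i j)) , ≈-refl

  IsSp-reduceB : ∀ {n} {γ : ℤᴹ.Block n} → ℤᴹ.IsSp γ → IsSp (reduceB γ)
  IsSp-reduceB {γ = γ} γ-sp =
    ≈B-trans (·-cong (·-congˡ (trB (reduceB γ)) (≈B-sym reduceB-J)) ≈B-refl)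
    (≈B-trans (≈B-sym (≈B-trans (reduceB-· (ℤᴹ.trB γ ℤᴹ.· ℤᴹ.J) γ) (·-congʳ (reduceB γ) (reduceB-· (ℤᴹ.trB γ) ℤᴹ.J))))
    (≈B-trans (reduceB-cong γ-sp) reduceB-J))

open Reduction

-- The double cosets

-- Opened only here: its names coincide with those of Matrices.
open import Defs

-- Defs.Block and ℤᴹ.Block hold the same matrices; only the sum sumℤ and the identity 𝐈 of Defs are
-- defined differently.
toℤᴹ : ∀ {g} → Block g → ℤᴹ.Block g
toℤᴹ M = ℤᴹ.⟦ A M , B M , C M , D M ⟧

fromℤᴹ : ∀ {g} → ℤᴹ.Block g → Block g
fromℤᴹ M = ⟦ ℤᴹ.A M , ℤᴹ.B M , ℤᴹ.C M , ℤᴹ.D M ⟧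

sumℤ≡sum : ∀ {n} (f : Fin n → ℤ) → sumℤ f ≡ ℤᴹ.sum f
sumℤ≡sum {zero}  f = refl
sumℤ≡sum {suc n} f = cong (ℤ._+_ (f zero)) (sumℤ≡sum (f ∘ suc))

𝐈≡δ : ∀ {n} (i j : Fin n) → 𝐈 i j ≡ ℤᴹ.δ i j
𝐈≡δ zero    zero    = refl
𝐈≡δ zero    (suc j) = refl
𝐈≡δ (suc i) zero    = refl
𝐈≡δ (suc i) (suc j) = trans 𝐈-suc (𝐈≡δ i j)
  where
  𝐈-suc : 𝐈 (suc i) (suc j) ≡ 𝐈 i j
  𝐈-suc with i ≟ j
  ... | yes _ = refl
  ... | no  _ = refl

toℤᴹ-· : ∀ {g} (M N : Block g) → toℤᴹ (M · N) ℤᴹ.≈B toℤᴹ M ℤᴹ.· toℤᴹ N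
toℤᴹ-· M N = entry (A M) (A N) (B M) (C N) , entry (A M) (B N) (B M) (D N) ,
             entry (C M) (A N) (D M) (C N) , entry (C M) (B N) (D M) (D N)
  where
  entry : ∀ {n} (X Y Z W : Mat n) → (X ⊗ Y ⊕ Z ⊗ W) ℤᴹ.≈ (X ℤᴹ.⊗ Y ℤᴹ.⊕ Z ℤᴹ.⊗ W)
  entry {n} X Y Z W i j = cong₂ ℤ._+_ (sumℤ≡sum {n} _) (sumℤ≡sum {n} _)

toℤᴹ-J : ∀ {g} → toℤᴹ (J {g}) ℤᴹ.≈B ℤᴹ.J
toℤᴹ-J = ℤᴹ.≈-refl , 𝐈≡δ , (λ i j → cong ℤ.-_ (𝐈≡δ i j)) , ℤᴹ.≈-refl

toℤᴹ-𝐈B : ∀ {g} → toℤᴹ (𝐈B {g}) ℤᴹ.≈B ℤᴹ.𝐈B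
toℤᴹ-𝐈B = 𝐈≡δ , ℤᴹ.≈-refl , ℤᴹ.≈-refl , 𝐈≡δ

toℤᴹ-M₁ : ∀ {g} → toℤᴹ (M₁ {g}) ℤᴹ.≈B ℤᴹ.M₁
toℤᴹ-M₁ = 𝐈≡δ , ℤᴹ.≈-refl , 𝐈≡δ , 𝐈≡δ

toℤᴹ-·-· : ∀ {g} (M N P : Block g) → toℤᴹ (M · N · P) ℤᴹ.≈B toℤᴹ M ℤᴹ.· toℤᴹ N ℤᴹ.· toℤᴹ P
toℤᴹ-·-· M N P = ℤᴹ.≈B-trans (toℤᴹ-· (M · N) P) (ℤᴹ.·-congʳ (toℤᴹ P) (toℤᴹ-· M N))

IsSp⇒IsSpᴹ : ∀ {g} {γ : Block g} → IsSp γ → ℤᴹ.IsSp (toℤᴹ γ)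
IsSp⇒IsSpᴹ {γ = γ} γ-sp =
  ℤᴹ.≈B-trans (ℤᴹ.·-congʳ (toℤᴹ γ) (ℤᴹ.·-congˡ (ℤᴹ.trB (toℤᴹ γ)) (ℤᴹ.≈B-sym toℤᴹ-J)))
  (ℤᴹ.≈B-trans (ℤᴹ.≈B-sym (toℤᴹ-·-· (trB γ) J γ)) (ℤᴹ.≈B-trans γ-sp toℤᴹ-J))

IsSpᴹ⇒IsSp : ∀ {g} {γ : ℤᴹ.Block g} → ℤᴹ.IsSp γ → IsSp (fromℤᴹ γ)
IsSpᴹ⇒IsSp {γ = γ} γ-sp =
  ℤᴹ.≈B-trans (toℤᴹ-·-· (trB (fromℤᴹ γ)) J (fromℤᴹ γ))
  (ℤᴹ.≈B-trans (ℤᴹ.·-congʳ γ (ℤᴹ.·-congˡ (ℤᴹ.trB γ) toℤᴹ-J))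
  (ℤᴹ.≈B-trans γ-sp (ℤᴹ.≈B-sym toℤᴹ-J)))


χℤ : ∀ {g} → ℤᴹ.Block g → F₂.BlockVector g
χℤ M = F₂.χ (reduceB M)

char : ∀ {g} → Block g → F₂.BlockVector g
char γ = χℤ (toℤᴹ γ)

χℤ-cong : ∀ {g} {M N : ℤᴹ.Block g} → M ℤᴹ.≈B N → χℤ M F₂.≋ χℤ N
χℤ-cong = F₂.χ-cong ∘ reduceB-cong

χℤ-· : ∀ {g} {M : ℤᴹ.Block g} → ℤᴹ.IsSp M → ∀ N →
       χℤ (M ℤᴹ.· N) F₂.≋ F₂.act (F₂.trB (reduceB N)) (χℤ M) F₂.⊞ χℤ N
χℤ-· {M = M} M-sp N = F₂.≋-trans (F₂.χ-cong (reduceB-· M N)) (F₂.χ-· (IsSp-reduceB M-sp) (reduceB N))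

parityℤ-diag : ∀ {g} (X Y : Mat g) i → parityℤ ((X ⊗ tr Y) i i) ≡ F₂.diag (F₂.tr (F₂.tr (reduce X)) F₂.⊗ F₂.tr (reduce Y)) i
parityℤ-diag {g} X Y i = trans (cong parityℤ (sumℤ≡sum (λ k → X i k ℤ.* Y i k)))
                        (trans (parityℤ-sum (λ k → X i k ℤ.* Y i k)) (F₂.sum-cong-≗ {g} (λ k → parityℤ-* (X i k) (Y i k))))

InTheta⇒χᵀ≋0 : ∀ {g} {h : Block g} → InTheta h → F₂.χ (F₂.trB (reduceB (toℤᴹ h))) F₂.≋ F₂.0₂
InTheta⇒χᵀ≋0 {h = h} (_ , AB′-even , CD′-even) =
  (λ i → trans (sym (parityℤ-diag (A h) (B h) i)) (2∣⇒parity≡0 (AB′-even i))) ,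
  (λ i → trans (sym (parityℤ-diag (C h) (D h) i)) (2∣⇒parity≡0 (CD′-even i)))

χᵀ≋0⇒InTheta : ∀ {g} {h : Block g} → IsSp h → F₂.χ (F₂.trB (reduceB (toℤᴹ h))) F₂.≋ F₂.0₂ → InTheta h
χᵀ≋0⇒InTheta {h = h} h-sp (α≗0 , β≗0) =
  h-sp ,
  (λ i → parity≡0⇒2∣ _ (trans (parityℤ-diag (A h) (B h) i) (α≗0 i))) ,
  (λ i → parity≡0⇒2∣ _ (trans (parityℤ-diag (C h) (D h) i) (β≗0 i)))

χℤ-θ· : ∀ {g} {h : Block g} → InTheta h → ∀ N → χℤ (toℤᴹ h ℤᴹ.· N) F₂.≋ χℤ N
χℤ-θ· {h = h} h-θ N =
  F₂.≋-trans (F₂.χ-cong (reduceB-· (toℤᴹ h) N))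
             (F₂.χ-·-invariant h̄-sp (F₂.χᵀ≋0⇒χ≋0 h̄-sp (InTheta⇒χᵀ≋0 h-θ)) (reduceB N))
  where
  h̄-sp : F₂.IsSp (reduceB (toℤᴹ h))
  h̄-sp = IsSp-reduceB (IsSp⇒IsSpᴹ (proj₁ h-θ))

SameRightCoset⇒char≋ : ∀ {g} {γ₁ γ₂ : Block g} → SameRightCoset γ₁ γ₂ → char γ₁ F₂.≋ char γ₂
SameRightCoset⇒char≋ {γ₂ = γ₂} (h , h-θ , γ₁≈hγ₂) =
  F₂.≋-trans (χℤ-cong (ℤᴹ.≈B-trans γ₁≈hγ₂ (toℤᴹ-· h γ₂))) (χℤ-θ· h-θ (toℤᴹ γ₂))

InDoubleCoset⇒char≋ : ∀ {g} {m γ : Block g} → InDoubleCoset m γ →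
                      ∃[ d ] InDelta d × char γ F₂.≋ χℤ (toℤᴹ m ℤᴹ.· toℤᴹ d)
InDoubleCoset⇒char≋ {m = m} (h , d , h-θ , d-Δ , γ≈hmd) =
  d , d-Δ , F₂.≋-trans (χℤ-cong (ℤᴹ.≈B-trans γ≈hmd (ℤᴹ.≈B-trans (toℤᴹ-·-· h m d) (ℤᴹ.·-assoc (toℤᴹ h) (toℤᴹ m) (toℤᴹ d)))))
                       (χℤ-θ· h-θ (toℤᴹ m ℤᴹ.· toℤᴹ d))

χℤ-𝐈B : ∀ {g} → χℤ (ℤᴹ.𝐈B {g}) F₂.≋ F₂.0₂
χℤ-𝐈B = F₂.≋-trans (F₂.χ-cong (reduce-𝐈 , F₂.≈-refl , F₂.≈-refl , reduce-𝐈)) F₂.χ-𝐈B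

char≋⇒SameRightCoset : ∀ {g} {γ : Block g} {N : ℤᴹ.Block g} → IsSp γ → ℤᴹ.IsSp N → ℤᴹ.IsSpᵀ N →
                       char γ F₂.≋ χℤ N → SameRightCoset γ (fromℤᴹ N)
char≋⇒SameRightCoset {g} {γ} {N} γ-sp N-sp N-spᵀ charγ≋χN =
  fromℤᴹ h , χᵀ≋0⇒InTheta (IsSpᴹ⇒IsSp h-sp) (F₂.χ≋0⇒χᵀ≋0 (IsSp-reduceB h-sp) χh≋0) , γ≈hN
  where
  Γ = toℤᴹ γ
  L = ℤᴹ.sp⁻¹ N
  h = Γ ℤᴹ.· L
  Γ-sp : ℤᴹ.IsSp Γ
  Γ-sp = IsSp⇒IsSpᴹ γ-sp
  h-sp : ℤᴹ.IsSp h
  h-sp = ℤᴹ.IsSp-· Γ-sp (ℤᴹ.IsSp-sp⁻¹ N-spᵀ)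
  -- χ (Γ L) = Lᵀ (χ Γ) + χ L = Lᵀ (χ N) + χ L = χ (N L) = χ 𝐈B = 0
  χh≋0 : χℤ h F₂.≋ F₂.0₂
  χh≋0 =
    F₂.≋-trans (χℤ-· Γ-sp L)
    (F₂.≋-trans (F₂.+ᵥ-cong (proj₁ shift) (λ _ → refl) , F₂.+ᵥ-cong (proj₂ shift) (λ _ → refl))
    (F₂.≋-trans (F₂.≋-sym (χℤ-· N-sp L))
    (F₂.≋-trans (χℤ-cong (ℤᴹ.sp⁻¹-inverseʳ N-spᵀ)) χℤ-𝐈B)))
    where
    shift : F₂.act (F₂.trB (reduceB L)) (char γ) F₂.≋ F₂.act (F₂.trB (reduceB L)) (χℤ N)
    shift = F₂.act-cong (F₂.≈B-refl {M = F₂.trB (reduceB L)}) charγ≋χN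
  γ≈hN : γ ≈B fromℤᴹ h · fromℤᴹ N
  γ≈hN = ℤᴹ.≈B-sym (ℤᴹ.≈B-trans (toℤᴹ-· (fromℤᴹ h) (fromℤᴹ N))
           (ℤᴹ.≈B-trans (ℤᴹ.·-assoc Γ L N)
           (ℤᴹ.≈B-trans (ℤᴹ.·-congˡ Γ (ℤᴹ.sp⁻¹-inverseˡ N-sp)) (ℤᴹ.·-identityʳ Γ))))

module _ {g : ℕ} where
  open F₂ using (_≋_; 0ᵥ)

  reduce-liftℤ-diagonal : ∀ (β : Vector Parity g) → reduce (ℤᴹ.diagonal (liftℤ ∘ β)) F₂.≈ F₂.diagonal β
  reduce-liftℤ-diagonal β i j = trans (parityℤ-* (liftℤ (β i)) (ℤᴹ.δ i j)) (cong₂ ℙ._*_ (parityℤ-liftℤ (β i)) (parityℤ-δ i j))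

  shearBy : Vector Parity g → ℤᴹ.Block g
  shearBy β = ℤᴹ.⟦ ℤᴹ.𝐈 , ℤᴹ.diagonal (liftℤ ∘ β) , ℤᴹ.𝟎 , ℤᴹ.𝐈 ⟧

  IsSp-shearBy : ∀ β → ℤᴹ.IsSp (shearBy β)
  IsSp-shearBy β = ℤᴹ.IsSp-upperShear (ℤᴹ.diagonal-symmetric (liftℤ ∘ β))

  IsSpᵀ-shearBy : ∀ β → ℤᴹ.IsSpᵀ (shearBy β)
  IsSpᵀ-shearBy β = ℤᴹ.IsSpᵀ-upperShear (ℤᴹ.diagonal-symmetric (liftℤ ∘ β))

  χℤ-shearBy : ∀ β → χℤ (shearBy β) ≋ (0ᵥ , β)
  χℤ-shearBy β = F₂.≋-trans (F₂.χ-cong (reduce-𝐈 , reduce-liftℤ-diagonal β , F₂.≈-refl , reduce-𝐈))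
               (F₂.≋-trans (F₂.χ-upperShear (F₂.diagonal β))
                           ((λ _ → refl) , (λ i → trans (cong (β i ℙ.*_) (F₂.δ-diag i)) (F₂.*-identityʳ (β i)))))

-- For even (α, β) with αₖ = 1, an element d = diag(Eᵀ, E⁻¹) · (𝐈 S; 0 𝐈) of Δ with χ (M₁ · d) = (α, β):
-- E = 𝐈 + ᾱ eₖᵀ with ᾱ = 1 + α sends 1ᵥ to α modulo 2, and S = b̄ eₖᵀ + eₖ b̄ᵀ, where b̄ is β with its
-- k-th entry cleared, gives S α + diag S = β because α · β = 0.
module M₁-representative {g : ℕ} (α β : Vector Parity g) (k : Fin g) (αₖ≡1 : α k ≡ 1ℙ) (αβ≡0 : F₂.dot α β ≡ 0ℙ) where
  open F₂ using (_≋_; 0ᵥ; 1ᵥ; _+_; _*_)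

  ᾱ b̄ : Vector Parity g
  ᾱ i = 1ℙ + α i
  b̄ i = β i * (1ℙ + F₂.δ i k)

  N : ℤᴹ.Matrix g
  N = ℤᴹ.outer (liftℤ ∘ ᾱ) (ℤᴹ.e k)

  E F S : ℤᴹ.Matrix g
  E = ℤᴹ.𝐈 ℤᴹ.⊕ N
  F = ℤᴹ.𝐈 ℤᴹ.⊕ ℤᴹ.neg N
  S = ℤᴹ.outer (liftℤ ∘ b̄) (ℤᴹ.e k) ℤᴹ.⊕ ℤᴹ.outer (ℤᴹ.e k) (liftℤ ∘ b̄)

  N²≈𝟎 : N ℤᴹ.⊗ N ℤᴹ.≈ ℤᴹ.𝟎
  N²≈𝟎 = ℤᴹ.outer⊗outer (liftℤ ∘ ᾱ) (ℤᴹ.e k) (trans (ℤᴹ.dot-e k (liftℤ ∘ ᾱ)) (cong (λ a → liftℤ (1ℙ + a)) αₖ≡1))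

  S-symmetric : S ℤᴹ.≈ ℤᴹ.tr S
  S-symmetric i j = trans (ℤₚ.+-comm (liftℤ (b̄ i) ℤ.* ℤᴹ.e k j) (ℤᴹ.e k i ℤ.* liftℤ (b̄ j)))
                          (cong₂ ℤ._+_ (ℤₚ.*-comm (ℤᴹ.e k i) (liftℤ (b̄ j))) (ℤₚ.*-comm (liftℤ (b̄ i)) (ℤᴹ.e k j)))

  diagonalPart shear d : ℤᴹ.Block g
  diagonalPart = ℤᴹ.⟦ ℤᴹ.tr E , ℤᴹ.𝟎 , ℤᴹ.𝟎 , F ⟧
  shear = ℤᴹ.⟦ ℤᴹ.𝐈 , S , ℤᴹ.𝟎 , ℤᴹ.𝐈 ⟧
  d = diagonalPart ℤᴹ.· shear

  IsSp-diagonalPart : ℤᴹ.IsSp diagonalPart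
  IsSp-diagonalPart = ℤᴹ.IsSp-diagonal (ℤᴹ.square-zero⇒inverse N²≈𝟎)

  IsSp-d : ℤᴹ.IsSp d
  IsSp-d = ℤᴹ.IsSp-· {M = diagonalPart} {N = shear} IsSp-diagonalPart (ℤᴹ.IsSp-upperShear S-symmetric)

  IsSpᵀ-d : ℤᴹ.IsSpᵀ d
  IsSpᵀ-d = ℤᴹ.IsSpᵀ-· {M = diagonalPart} {N = shear} (ℤᴹ.IsSpᵀ-diagonal (ℤᴹ.≈-trans (ℤᴹ.≈-sym (ℤᴹ.tr-⊗ F E))
                                          (ℤᴹ.≈-trans (λ i j → ℤᴹ.square-zero⇒inverse′ N²≈𝟎 j i) ℤᴹ.tr-𝐈)))
                       (ℤᴹ.IsSpᵀ-upperShear S-symmetric)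

  C-d≈𝟎 : ℤᴹ.C d ℤᴹ.≈ ℤᴹ.𝟎
  C-d≈𝟎 i j = trans (cong₂ ℤ._+_ (ℤᴹ.⊗-zeroˡ ℤᴹ.𝐈 i j) (ℤᴹ.⊗-zeroʳ F i j)) refl

  reduce-E : reduce E F₂.≈ F₂.𝐈 F₂.⊕ F₂.outer ᾱ (F₂.e k)
  reduce-E i j = trans (parityℤ-+ (ℤᴹ.δ i j) (liftℤ (ᾱ i) ℤ.* ℤᴹ.δ j k))
                 (cong₂ ℙ._+_ (parityℤ-δ i j)
                   (trans (parityℤ-* (liftℤ (ᾱ i)) (ℤᴹ.δ j k)) (cong₂ ℙ._*_ (parityℤ-liftℤ (ᾱ i)) (parityℤ-δ j k))))

  reduce-S : reduce S F₂.≈ F₂.outer b̄ (F₂.e k) F₂.⊕ F₂.outer (F₂.e k) b̄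
  reduce-S i j = trans (parityℤ-+ (liftℤ (b̄ i) ℤ.* ℤᴹ.δ j k) (ℤᴹ.δ i k ℤ.* liftℤ (b̄ j)))
                 (cong₂ ℙ._+_ (trans (parityℤ-* (liftℤ (b̄ i)) (ℤᴹ.δ j k)) (cong₂ ℙ._*_ (parityℤ-liftℤ (b̄ i)) (parityℤ-δ j k)))
                              (trans (parityℤ-* (ℤᴹ.δ i k) (liftℤ (b̄ j))) (cong₂ ℙ._*_ (parityℤ-δ i k) (parityℤ-liftℤ (b̄ j)))))

  Ē▹1≗α : reduce E F₂.▹ 1ᵥ ≗ α
  Ē▹1≗α i = begin
    (reduce E F₂.▹ 1ᵥ) i
      ≡⟨ F₂.▹-cong reduce-E (λ _ → refl) i ⟩
    ((F₂.𝐈 F₂.⊕ F₂.outer ᾱ (F₂.e k)) F₂.▹ 1ᵥ) i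
      ≡⟨ F₂.▹-distribʳ-⊕ F₂.𝐈 (F₂.outer ᾱ (F₂.e k)) 1ᵥ i ⟩
    (F₂.𝐈 F₂.▹ 1ᵥ) i + (F₂.outer ᾱ (F₂.e k) F₂.▹ 1ᵥ) i
      ≡⟨ cong₂ ℙ._+_ (F₂.▹-identityˡ 1ᵥ i) (trans (F₂.outer-▹ ᾱ (F₂.e k) 1ᵥ i) (cong (ᾱ i *_) (F₂.dot-e k 1ᵥ))) ⟩
    1ℙ + ᾱ i * 1ℙ
      ≡⟨ cong (1ℙ +_) (F₂.*-identityʳ (ᾱ i)) ⟩
    1ℙ + (1ℙ + α i)
      ≡⟨ sym (F₂.+-assoc 1ℙ 1ℙ (α i)) ⟩
    α i ∎
    where open ≡-Reasoning

  b̄·α≡βₖ : F₂.dot b̄ α ≡ β k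
  b̄·α≡βₖ = begin
    F₂.sum (λ j → b̄ j * α j)
      ≡⟨ F₂.sum-cong-≗ {g} (λ j → expand (β j) (F₂.δ j k) (α j)) ⟩
    F₂.sum (λ j → β j * α j + β j * α j * F₂.δ j k)
      ≡⟨ F₂.∑-distrib-+ {g} _ _ ⟩
    F₂.dot β α + F₂.sum (λ j → β j * α j * F₂.δ j k)
      ≡⟨ cong₂ ℙ._+_ (trans (F₂.dot-comm β α) αβ≡0) (F₂.sum-δʳ k (λ j → β j * α j)) ⟩
    0ℙ + β k * α k
      ≡⟨ trans (cong (β k *_) αₖ≡1) (F₂.*-identityʳ (β k)) ⟩
    β k ∎
    where
    open ≡-Reasoning
    expand : ∀ x y z → x * (1ℙ + y) * z ≡ x * z + x * z * y
    expand x y z = begin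
      x * (1ℙ + y) * z              ≡⟨ cong (_* z) (F₂.distribˡ x 1ℙ y) ⟩
      (x * 1ℙ + x * y) * z        ≡⟨ F₂.distribʳ z (x * 1ℙ) (x * y) ⟩
      x * 1ℙ * z + x * y * z    ≡⟨ cong₂ ℙ._+_ (cong (_* z) (F₂.*-identityʳ x))
                                               (trans (F₂.*-assoc x y z) (trans (cong (x *_) (F₂.*-comm y z)) (sym (F₂.*-assoc x z y)))) ⟩
      x * z + x * z * y           ∎

  S̄α+diagS̄≗β : F₂.tr (reduce S) F₂.▹ α F₂.+ᵥ F₂.diag (reduce S) ≗ β
  S̄α+diagS̄≗β i = begin
    (F₂.tr (reduce S) F₂.▹ α) i + reduce S i i
      ≡⟨ cong₂ ℙ._+_ (F₂.▹-cong (λ p q → reduce-S q p) (λ _ → refl) i) diag-S̄≡0 ⟩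
    ((F₂.tr (F₂.outer b̄ (F₂.e k)) F₂.⊕ F₂.tr (F₂.outer (F₂.e k) b̄)) F₂.▹ α) i + 0ℙ
      ≡⟨ F₂.+-identityʳ _ ⟩
    ((F₂.tr (F₂.outer b̄ (F₂.e k)) F₂.⊕ F₂.tr (F₂.outer (F₂.e k) b̄)) F₂.▹ α) i
      ≡⟨ F₂.▹-distribʳ-⊕ (F₂.tr (F₂.outer b̄ (F₂.e k))) (F₂.tr (F₂.outer (F₂.e k) b̄)) α i ⟩
    (F₂.tr (F₂.outer b̄ (F₂.e k)) F₂.▹ α) i + (F₂.tr (F₂.outer (F₂.e k) b̄) F₂.▹ α) i
      ≡⟨ cong₂ ℙ._+_ (trans (F₂.tr-outer-▹ b̄ (F₂.e k) α i) (cong (F₂.δ i k *_) b̄·α≡βₖ))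
                     (trans (F₂.tr-outer-▹ (F₂.e k) b̄ α i) (trans (cong (b̄ i *_) (trans (F₂.dot-e k α) αₖ≡1)) (F₂.*-identityʳ (b̄ i)))) ⟩
    F₂.δ i k * β k + b̄ i
      ≡⟨ restore (F₂.δ-cases i k) ⟩
    β i ∎
    where
    open ≡-Reasoning
    diag-S̄≡0 : reduce S i i ≡ 0ℙ
    diag-S̄≡0 = trans (reduce-S i i) (trans (cong (b̄ i * F₂.e k i +_) (F₂.*-comm (F₂.e k i) (b̄ i))) (F₂.x+x≡0 (b̄ i * F₂.e k i)))
    restore : (i ≡ k) ⊎ (F₂.δ i k ≡ 0ℙ) → F₂.δ i k * β k + b̄ i ≡ β i
    restore (inj₁ refl) = begin
      F₂.δ i i * β i + β i * (1ℙ + F₂.δ i i)  ≡⟨ cong (λ t → t * β i + β i * (1ℙ + t)) (F₂.δ-diag i) ⟩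
      1ℙ * β i + β i * 0ℙ                        ≡⟨ cong (β i ℙ.+_) (F₂.zeroʳ (β i)) ⟩
      β i + 0ℙ                                        ≡⟨ F₂.+-identityʳ (β i) ⟩
      β i                                               ∎
    restore (inj₂ δᵢₖ≡0) = begin
      F₂.δ i k * β k + β i * (1ℙ + F₂.δ i k)  ≡⟨ cong (λ t → t * β k + β i * (1ℙ + t)) δᵢₖ≡0 ⟩
      β i * 1ℙ                                        ≡⟨ F₂.*-identityʳ (β i) ⟩
      β i                                               ∎

  χℤ-M₁·d : χℤ (ℤᴹ.M₁ ℤᴹ.· d) ≋ (α , β)
  χℤ-M₁·d =
    F₂.≋-trans (F₂.χ-cong (F₂.≈B-trans (reduceB-· ℤᴹ.M₁ d)
                           (F₂.·-cong (reduce-𝐈 , F₂.≈-refl , reduce-𝐈 , reduce-𝐈)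
                             (F₂.≈B-trans (reduceB-· diagonalPart shear)
                               (F₂.·-congˡ (reduceB diagonalPart) (reduce-𝐈 , F₂.≈-refl , F₂.≈-refl , reduce-𝐈))))))
    (F₂.≋-trans (F₂.χ-M₁·diagonal·shear (IsSp-reduceB IsSp-diagonalPart))
                (Ē▹1≗α , λ i → trans (cong (_+ reduce S i i) (F₂.▹-cong (F₂.≈-refl {X = F₂.tr (reduce S)}) Ē▹1≗α i)) (S̄α+diagS̄≗β i)))

IsSp-via : ∀ {g} {γ : Block g} {N : ℤᴹ.Block g} → toℤᴹ γ ℤᴹ.≈B N → ℤᴹ.IsSp N → IsSp γ
IsSp-via γ≈N N-sp = IsSpᴹ⇒IsSp (ℤᴹ.IsSp-cong (ℤᴹ.≈B-sym γ≈N) N-sp)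

InTheta-𝐈B : ∀ {g} → InTheta (𝐈B {g})
InTheta-𝐈B {g} = χᵀ≋0⇒InTheta {h = 𝐈B} (IsSp-via toℤᴹ-𝐈B ℤᴹ.IsSp-𝐈B)
                               ((λ i → F₂.⊗-zeroʳ (reduce (𝐈 {g})) i i) , (λ i → F₂.⊗-zeroˡ (F₂.tr (reduce (𝐈 {g}))) i i))

∈DoubleCoset : ∀ {g} (m : Block g) {d : ℤᴹ.Block g} → ℤᴹ.IsSp d → ℤᴹ.C d ℤᴹ.≈ ℤᴹ.𝟎 →
               InDoubleCoset m (fromℤᴹ (toℤᴹ m ℤᴹ.· d))
∈DoubleCoset m {d} d-sp C≈𝟎 =
  𝐈B , fromℤᴹ d , InTheta-𝐈B , (IsSpᴹ⇒IsSp d-sp , C≈𝟎) ,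
  ℤᴹ.≈B-sym (ℤᴹ.≈B-trans (toℤᴹ-·-· 𝐈B m (fromℤᴹ d))
              (ℤᴹ.≈B-trans (ℤᴹ.·-congʳ d (ℤᴹ.·-congʳ (toℤᴹ m) toℤᴹ-𝐈B)) (ℤᴹ.·-congʳ d (ℤᴹ.·-identityˡ (toℤᴹ m)))))

reduce-C≈𝟎 : ∀ {g} {d : Block g} → InDelta d → reduce (C d) F₂.≈ F₂.𝟎
reduce-C≈𝟎 (_ , C≈𝟎) i j = cong parityℤ (C≈𝟎 i j)

α-𝐈B-coset : ∀ {g} {γ : Block g} → InDoubleCoset 𝐈B γ → proj₁ (char γ) ≗ F₂.0ᵥ
α-𝐈B-coset {γ = γ} coset = from-Δ (InDoubleCoset⇒char≋ {m = 𝐈B} coset)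
  where
  from-Δ : (∃[ d ] InDelta d × char γ F₂.≋ χℤ (toℤᴹ 𝐈B ℤᴹ.· toℤᴹ d)) → proj₁ (char γ) ≗ F₂.0ᵥ
  from-Δ (d , d-Δ , charγ≋) i = trans (proj₁ charγ≋ i)
    (trans (proj₁ (χℤ-cong (ℤᴹ.≈B-trans (ℤᴹ.·-congʳ (toℤᴹ d) toℤᴹ-𝐈B) (ℤᴹ.·-identityˡ (toℤᴹ d)))) i)
           (F₂.α-lower-zero {d = reduceB (toℤᴹ d)} (reduce-C≈𝟎 d-Δ) i))

α-M₁-coset : ∀ {n} {γ : Block (suc n)} → InDoubleCoset M₁ γ → proj₁ (char γ) ≗ F₂.0ᵥ → ⊥
α-M₁-coset {n} {γ} coset α≗0 = from-Δ (InDoubleCoset⇒char≋ {m = M₁} coset)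
  where
  1ℙ≢0ℙ : 1ℙ ≡ 0ℙ → ⊥
  1ℙ≢0ℙ ()
  from-Δ : (∃[ d ] InDelta d × char γ F₂.≋ χℤ (toℤᴹ M₁ ℤᴹ.· toℤᴹ d)) → ⊥
  from-Δ (d , d-Δ , charγ≋) = 1ℙ≢0ℙ (F₂.IsSp-lower-zero⇒Aᵀ-injective {d = d̄} d̄-sp (reduce-C≈𝟎 {d = d} d-Δ) F₂.1ᵥ Aᵀ1≗0 zero)
    where
    d̄ = reduceB (toℤᴹ d)
    d̄-sp : F₂.IsSp d̄
    d̄-sp = IsSp-reduceB {γ = toℤᴹ d} (IsSp⇒IsSpᴹ {γ = d} (proj₁ d-Δ))
    Aᵀ1≗0 : F₂.tr (F₂.A d̄) F₂.▹ F₂.1ᵥ ≗ F₂.0ᵥ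
    Aᵀ1≗0 i = trans (sym (F₂.α-M₁·lower-zero {d = d̄} (reduce-C≈𝟎 {d = d} d-Δ) i))
              (trans (sym (proj₁ (F₂.χ-cong (F₂.≈B-trans (reduceB-· (toℤᴹ M₁) (toℤᴹ d))
                                                         (F₂.·-congʳ d̄ (F₂.≈B-trans (reduceB-cong toℤᴹ-M₁) (reduce-𝐈 , F₂.≈-refl , reduce-𝐈 , reduce-𝐈))))) i))
              (trans (sym (proj₁ charγ≋ i)) (α≗0 i)))

SameRightCoset⇒InDoubleCoset : ∀ {g} {γ m : Block g} {d : ℤᴹ.Block g} → ℤᴹ.IsSp d → ℤᴹ.C d ℤᴹ.≈ ℤᴹ.𝟎 →
                               SameRightCoset γ (fromℤᴹ (toℤᴹ m ℤᴹ.· d)) → InDoubleCoset m γ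
SameRightCoset⇒InDoubleCoset {m = m} {d} d-sp C≈𝟎 (h , h-θ , γ≈hr) =
  h , fromℤᴹ d , h-θ , (IsSpᴹ⇒IsSp d-sp , C≈𝟎) ,
  ℤᴹ.≈B-trans γ≈hr (ℤᴹ.≈B-trans (toℤᴹ-· h (fromℤᴹ (toℤᴹ m ℤᴹ.· d)))
    (ℤᴹ.≈B-trans (ℤᴹ.≈B-sym (ℤᴹ.·-assoc (toℤᴹ h) (toℤᴹ m) d)) (ℤᴹ.≈B-sym (toℤᴹ-·-· h m (fromℤᴹ d)))))

-- Labels in S for the right cosets of Γ(1,2) inside Γ(1,2) · m · Δ, with representatives m · δ-part x.
record Parametrisation {g : ℕ} (m : Block g) (S : Setoid 0ℓ 0ℓ) : Set where
  open Setoid S using (Carrier) renaming (_≈_ to _≈ₛ_)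
  field
    m-IsSp          : ℤᴹ.IsSp (toℤᴹ m)
    m-IsSpᵀ         : ℤᴹ.IsSpᵀ (toℤᴹ m)
    label           : Carrier → F₂.BlockVector g
    label-cong      : ∀ {x y} → x ≈ₛ y → label x F₂.≋ label y
    label-injective : ∀ {x y} → label x F₂.≋ label y → x ≈ₛ y
    δ-part          : Carrier → ℤᴹ.Block g
    δ-part-IsSp     : ∀ x → ℤᴹ.IsSp (δ-part x)
    δ-part-IsSpᵀ    : ∀ x → ℤᴹ.IsSpᵀ (δ-part x)
    δ-part-C≈𝟎      : ∀ x → ℤᴹ.C (δ-part x) ℤᴹ.≈ ℤᴹ.𝟎
    χℤ-m·δ-part     : ∀ x → χℤ (toℤᴹ m ℤᴹ.· δ-part x) F₂.≋ label x
    classify        : ∀ γ → IsSp γ → InDoubleCoset m γ → ∃ λ x → char γ F₂.≋ label x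

  representative : Carrier → Block g
  representative x = fromℤᴹ (toℤᴹ m ℤᴹ.· δ-part x)

  label⇒SameRightCoset : ∀ {γ} → IsSp γ → ∀ x → char γ F₂.≋ label x → SameRightCoset γ (representative x)
  label⇒SameRightCoset γ-sp x charγ≋ =
    char≋⇒SameRightCoset γ-sp (ℤᴹ.IsSp-· m-IsSp (δ-part-IsSp x)) (ℤᴹ.IsSpᵀ-· m-IsSpᵀ (δ-part-IsSpᵀ x))
                         (F₂.≋-trans charγ≋ (F₂.≋-sym (χℤ-m·δ-part x)))

  label⇒InDoubleCoset : ∀ {γ} → IsSp γ → ∀ x → char γ F₂.≋ label x → InDoubleCoset m γ
  label⇒InDoubleCoset γ-sp x charγ≋ =
    SameRightCoset⇒InDoubleCoset (δ-part-IsSp x) (δ-part-C≈𝟎 x) (label⇒SameRightCoset γ-sp x charγ≋)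

  HasNRightCosets-from : ∀ {N} → Enumeration S N → HasNRightCosets m N
  HasNRightCosets-from enum = representative ∘ decode , members , distinct , cover
    where
    open Enumeration enum
    open Setoid S using () renaming (sym to ≈ₛ-sym)
    members : ∀ i → IsSp (representative (decode i)) × InDoubleCoset m (representative (decode i))
    members i = IsSpᴹ⇒IsSp (ℤᴹ.IsSp-· m-IsSp (δ-part-IsSp (decode i))) ,
                ∈DoubleCoset m (δ-part-IsSp (decode i)) (δ-part-C≈𝟎 (decode i))
    distinct : ∀ i j → SameRightCoset (representative (decode i)) (representative (decode j)) → i ≡ j
    distinct i j same = decode-injective (label-injective
      (F₂.≋-trans (F₂.≋-sym (χℤ-m·δ-part (decode i)))
      (F₂.≋-trans (SameRightCoset⇒char≋ same) (χℤ-m·δ-part (decode j)))))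
    cover : ∀ γ → IsSp γ → InDoubleCoset m γ → ∃[ i ] SameRightCoset γ (representative (decode i))
    cover γ γ-sp coset = let (x , charγ≋) = classify γ γ-sp coset in
      encode x , label⇒SameRightCoset γ-sp (decode (encode x)) (F₂.≋-trans charγ≋ (label-cong (≈ₛ-sym (decode-encode x))))

zero-or-pivot : ∀ {n} (v : Vector Parity n) → v ≗ F₂.0ᵥ ⊎ F₂.HasPivot v
zero-or-pivot v with Finₚ.any? (λ k → v k ℙₚ.≟ 1ℙ)
... | yes pivot = inj₂ pivot
... | no  ¬pivot = inj₁ (λ k → not-1⇒0 (v k) (λ vₖ≡1 → ¬pivot (k , vₖ≡1)))
  where
  not-1⇒0 : ∀ p → p ≢ 1ℙ → p ≡ 0ℙ
  not-1⇒0 0ℙ _   = refl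
  not-1⇒0 1ℙ p≢1 = ⊥-elim (p≢1 refl)

char-even : ∀ {g} {γ : Block g} → IsSp γ → F₂.dot (proj₁ (char γ)) (proj₂ (char γ)) ≡ 0ℙ
char-even {γ = γ} γ-sp = F₂.χ-even {γ = reduceB (toℤᴹ γ)} (IsSp-reduceB {γ = toℤᴹ γ} (IsSp⇒IsSpᴹ {γ = γ} γ-sp))

module _ {g : ℕ} where

  𝐈B-cosets : Parametrisation (𝐈B {g}) (Fin g →-setoid Parity)
  𝐈B-cosets = record
    { m-IsSp          = ℤᴹ.IsSp-cong (ℤᴹ.≈B-sym toℤᴹ-𝐈B) ℤᴹ.IsSp-𝐈B
    ; m-IsSpᵀ         = ℤᴹ.IsSp-cong (ℤᴹ.trB-cong (ℤᴹ.≈B-sym toℤᴹ-𝐈B)) ℤᴹ.IsSpᵀ-𝐈B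
    ; label           = λ β → F₂.0ᵥ , β
    ; label-cong      = λ β≗β′ → (λ _ → refl) , β≗β′
    ; label-injective = proj₂
    ; δ-part          = shearBy
    ; δ-part-IsSp     = IsSp-shearBy
    ; δ-part-IsSpᵀ    = IsSpᵀ-shearBy
    ; δ-part-C≈𝟎      = λ _ → ℤᴹ.≈-refl
    ; χℤ-m·δ-part     = λ β → F₂.≋-trans (χℤ-cong (ℤᴹ.≈B-trans (ℤᴹ.·-congʳ (shearBy β) toℤᴹ-𝐈B) (ℤᴹ.·-identityˡ (shearBy β))))
                                          (χℤ-shearBy β)
    ; classify        = λ γ _ coset → proj₂ (char γ) , α-𝐈B-coset coset , (λ _ → refl)
    }

module _ {n : ℕ} where

  M₁-cosets : Parametrisation (M₁ {suc n}) (F₂.char₁Setoid (suc n))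
  M₁-cosets = record
    { m-IsSp          = ℤᴹ.IsSp-cong (ℤᴹ.≈B-sym toℤᴹ-M₁) ℤᴹ.IsSp-M₁
    ; m-IsSpᵀ         = ℤᴹ.IsSp-cong (ℤᴹ.trB-cong (ℤᴹ.≈B-sym toℤᴹ-M₁)) ℤᴹ.IsSpᵀ-M₁
    ; label           = proj₁
    ; label-cong      = λ ζ≈ζ′ → ζ≈ζ′
    ; label-injective = λ ζ≋ζ′ → ζ≋ζ′
    ; δ-part          = λ (ζ , even , k , αₖ≡1) → M₁-representative.d (proj₁ ζ) (proj₂ ζ) k αₖ≡1 even
    ; δ-part-IsSp     = λ (ζ , even , k , αₖ≡1) → M₁-representative.IsSp-d (proj₁ ζ) (proj₂ ζ) k αₖ≡1 even
    ; δ-part-IsSpᵀ    = λ (ζ , even , k , αₖ≡1) → M₁-representative.IsSpᵀ-d (proj₁ ζ) (proj₂ ζ) k αₖ≡1 even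
    ; δ-part-C≈𝟎      = λ (ζ , even , k , αₖ≡1) → M₁-representative.C-d≈𝟎 (proj₁ ζ) (proj₂ ζ) k αₖ≡1 even
    ; χℤ-m·δ-part     = λ (ζ , even , k , αₖ≡1) →
                          F₂.≋-trans (χℤ-cong (ℤᴹ.·-congʳ (M₁-representative.d (proj₁ ζ) (proj₂ ζ) k αₖ≡1 even) toℤᴹ-M₁))
                                     (M₁-representative.χℤ-M₁·d (proj₁ ζ) (proj₂ ζ) k αₖ≡1 even)
    ; classify        = classify
    }
    where
    classify : ∀ γ → IsSp γ → InDoubleCoset M₁ γ → ∃ λ (x : F₂.Char₁ (suc n)) → char γ F₂.≋ proj₁ x
    classify γ γ-sp coset with zero-or-pivot (proj₁ (char γ))
    ... | inj₁ α≗0  = ⊥-elim (α-M₁-coset coset α≗0)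
    ... | inj₂ pivot = (char γ , char-even {γ = γ} γ-sp , pivot) , F₂.≋-refl

-- Only the statement uses ℕ's _*_ unqualified; earlier it would clash with that of 𝔽₂.
open import Data.Nat using (_*_)

proposition3p1 : (n : ℕ) →
    let g = suc n in
    (∀ (γ : Block g) → IsSp γ → InDoubleCoset 𝐈B γ ⊎ InDoubleCoset M₁ γ)
    × (∀ (γ : Block g) → InDoubleCoset 𝐈B γ → ¬ InDoubleCoset M₁ γ)
    × HasNRightCosets {g} 𝐈B (2 ^ g)
    × HasNRightCosets {g} M₁ (2 ^ n * (2 ^ g ∸ 1))
proposition3p1 n = covering , disjoint , 𝐈B-count , M₁-count
  where
  open Parametrisation
  covering : ∀ γ → IsSp γ → InDoubleCoset 𝐈B γ ⊎ InDoubleCoset M₁ γ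
  covering γ γ-sp with zero-or-pivot (proj₁ (char γ))
  ... | inj₁ α≗0   = inj₁ (label⇒InDoubleCoset 𝐈B-cosets γ-sp (proj₂ (char γ)) (α≗0 , λ _ → refl))
  ... | inj₂ pivot = inj₂ (label⇒InDoubleCoset M₁-cosets γ-sp (char γ , char-even {γ = γ} γ-sp , pivot) F₂.≋-refl)
  disjoint : ∀ γ → InDoubleCoset 𝐈B γ → ¬ InDoubleCoset M₁ γ
  disjoint γ upper-coset lower-coset = α-M₁-coset lower-coset (α-𝐈B-coset upper-coset)
  𝐈B-count : HasNRightCosets {suc n} 𝐈B (2 ^ suc n)
  𝐈B-count = HasNRightCosets-from 𝐈B-cosets (vectors F₂.parities (suc n))
  M₁-count : HasNRightCosets {suc n} M₁ (2 ^ n * (2 ^ suc n ∸ 1))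
  M₁-count = subst (HasNRightCosets M₁) (F₂.∣Char₁∣-closed-form n)
                     (HasNRightCosets-from M₁-cosets (F₂.char₁-enumeration (suc n)))
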